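{- For every integer $n\geq 2$, $$D_n=\left\lfloor \frac{n!}{e}+\frac1n\right\rfloor \quad\text{and}\quad D_n=\left\lfloor \frac{n!}{e}+\frac{n+2}{(n+1)^2}\right\rfloor .$$
   Context: $D_n$ denotes the number of derangements of $n$ distinct objects (permutations of an $n$-element set with no fixed point). $\lfloor x\rfloor$ denotes the floor of $x$. -}

module Defs where

open import Data.Nat as ℕ using (ℕ; zero; suc; _!)
open import Data.Nat.Properties using (_!≢0)
open import Data.Integer as ℤ using (+_)
open import Data.Rational as ℚ using (ℚ; _/_; _+_; _-_; _*_; _≤_; _<_; 0ℚ)
open import Data.Fin as Fin using (Fin)
open import Data.Fin.Properties as FinP using (all?)
open import Data.Vec as Vec using (Vec; []; _∷_; lookup; toList)
open import Data.List as List using (List; [_]; concatMap; map; length; filter)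
open import Data.List.Relation.Unary.Unique.Propositional using (Unique)
import Data.List.Relation.Unary.Unique.DecPropositional as UDec
open import Data.Product using (_×_; ∃)
open import Relation.Binary.PropositionalEquality using (_≢_)
open import Relation.Nullary using (¬?; Dec)
open import Relation.Nullary.Decidable using (_×-dec_)

-- A permutation of Fin n is represented by its table
-- (σ 0, σ 1, …, σ (n-1)) : Vec (Fin n) n, with all entries distinct
-- (an injective self-map of a finite set is a bijection).
IsDerangement : (n : ℕ) → Vec (Fin n) n → Set
IsDerangement n σ = Unique (toList σ) × (∀ i → lookup σ i ≢ i)

isDerangement? : (n : ℕ) → (σ : Vec (Fin n) n) → Dec (IsDerangement n σ)
isDerangement? n σ = UDec.unique? (Fin._≟_ {n}) (toList σ) ×-dec all? (λ i → ¬? (lookup σ i Fin.≟ i))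

allVecs : (n k : ℕ) → List (Vec (Fin n) k)
allVecs n zero    = [ [] ]
allVecs n (suc k) = concatMap (λ v → map (_∷ v) (List.allFin n)) (allVecs n k)

D : ℕ → ℕ
D n = length (filter (isDerangement? n) (allVecs n n))

-- The constant e, given as a Dedekind-style real via its partial sums
-- eSum N = Σ_{k=0}^{N} 1/k!, e = sup_N eSum N.

eSum : ℕ → ℚ
eSum zero    = + 1 / 1
eSum (suc N) = eSum N + (_/_ (+ 1) (suc N !) {{suc N !≢0}})

ℕ→ℚ : ℕ → ℚ
ℕ→ℚ k = + k / 1

-- For rationals t, a:   t·e ≤ a   (correct for t ≥ 0, e = sup eSum)
_·e≤_ : ℚ → ℚ → Set
t ·e≤ a = ∀ N → t * eSum N ≤ a

_<_·e : ℚ → ℚ → Set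
a < t ·e = ∃ λ N → a < t * eSum N

-- IsFloor n c m  :⇔  m = ⌊ n!/e + c ⌋, i.e.  m ≤ n!/e + c < m + 1.
-- Since e > 0:
--   m ≤ n!/e + c      ⇔  (m - c)·e ≤ n!
--   n!/e + c < m + 1  ⇔  n! < (m + 1 - c)·e
-- (When m - c ≤ 0 both sides of the first equivalence hold trivially,
--  and when m + 1 - c ≤ 0 both sides of the second are false.)
IsFloorFactOverEPlus : ℕ → ℚ → ℕ → Set
IsFloorFactOverEPlus n c m =
  ((ℕ→ℚ m - c) ·e≤ ℕ→ℚ (n !)) × (ℕ→ℚ (n !) < (ℕ→ℚ (suc m) - c) ·e)

{-# OPTIONS --safe #-}

-- Counting injective vectors that avoid a given injective vector pointwise yields a Pascal-type
-- recurrence, whence D (k + 2) = (k + 1) (D (k + 1) + D k) and D (k + 1) = (k + 1) D k + (-1)^(k+1).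
-- So d k = D k / k! is the k-th partial sum of Σ (-1)^i / i!: the d k with k odd increase, those with
-- k even decrease, and every later d j lies between them. The Cauchy product of this series with
-- Σ 1/i! is 1, i.e. Σ_{i+j=K} d j / i! = 1 for every K; together with the bracketing this gives, for the
-- partial sums e_N of e, e_N · d a ≤ 1 for odd a and 1 ≤ e_N · d b + b/(N+1)! for even b. Since
-- n! d n = D n and n! d (n+1) = D n ± 1/(n+1), choosing a, b ∈ {n, n+1} shows
-- D n - c ≤ n!/e < D n + 1 - c whenever 1/(n+1) ≤ c ≤ 1/2, and for n ≥ 2 both constants lie in that range.

module Submission where

open import Defs

module Counting where

  open import Data.Nat as ℕ using (ℕ; zero; suc; _+_; _*_; _!; _≤_; s≤s)
  open import Data.Nat.Properties as ℕ
    using ( +-*-semiring; +-assoc; +-comm; +-suc; +-identityʳ; +-cancelʳ-≡; *-assoc; *-comm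
          ; *-identityˡ; *-identityʳ; *-zeroʳ; *-distribˡ-+; *-distribʳ-+; m≤m+n; ≤-refl)
  open import Algebra.Properties.Semiring.Sum +-*-semiring
    using (sum; sum-syntax; sum-cong-≗; sum-remove; *-distribˡ-sum)
  open import Data.Fin as Fin using (Fin; punchIn; punchOut)
  open import Data.Fin.Properties as Fin using (punchIn-injective; punchIn-punchOut; punchInᵢ≢i; suc-injective)
  open import Data.Vec as Vec using (Vec; []; _∷_; lookup; toList)
  open import Data.Vec.Properties using (toList-map; lookup-map)
  open import Data.List as List using (List; _++_; filter; length; concatMap)
  open import Data.List.Relation.Unary.All as All using (All; []; _∷_)
  import Data.List.Relation.Unary.All.Properties as All
  open import Data.List.Relation.Unary.AllPairs using ([]; _∷_)
  open import Data.List.Relation.Unary.Unique.Propositional using (Unique)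
  import Data.List.Relation.Unary.Unique.Propositional.Properties as Unique
  import Data.List.Relation.Unary.Unique.DecPropositional as UniqueDec
  open import Data.Product using (_×_; _,_; proj₁)
  open import Function using (_∘_; id; flip)
  open import Function.Definitions using (Injective)
  open import Relation.Binary.PropositionalEquality
  open import Relation.Nullary using (¬_; ¬?; Dec; yes; no; contradiction)
  open import Relation.Nullary.Decidable using (_×-dec_)
  open import Relation.Unary using (Decidable)
  open import Data.Nat.Tactic.RingSolver using (solve-∀)
  open import Level using (Level)
  open import Algebra.Properties.CommutativeSemigroup ℕ.+-commutativeSemigroup using (interchange)
  open import Algebra.Properties.CommutativeSemigroup ℕ.*-commutativeSemigroup using (xy∙z≈y∙xz)

  private variable
    ℓ ℓ₁ ℓ₂ : Level
    A : Set ℓ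
    P : Set ℓ₁
    Q : Set ℓ₂

  𝟙 : Dec P → ℕ
  𝟙 (yes _) = 1
  𝟙 (no _)  = 0

  𝟙-cong : (P → Q) → (Q → P) → (p? : Dec P) (q? : Dec Q) → 𝟙 p? ≡ 𝟙 q?
  𝟙-cong _ _ (yes _) (yes _) = refl
  𝟙-cong f _ (yes p) (no ¬q) = contradiction (f p) ¬q
  𝟙-cong _ g (no ¬p) (yes q) = contradiction (g q) ¬p
  𝟙-cong _ _ (no _)  (no _)  = refl

  𝟙-× : (p? : Dec P) (q? : Dec Q) → 𝟙 (p? ×-dec q?) ≡ 𝟙 p? * 𝟙 q?
  𝟙-× (yes _) (yes _) = refl
  𝟙-× (yes _) (no _)  = refl
  𝟙-× (no _)  (yes _) = refl
  𝟙-× (no _)  (no _)  = refl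

  𝟙-yes : (p? : Dec P) → P → 𝟙 p? ≡ 1
  𝟙-yes (yes _) _ = refl
  𝟙-yes (no ¬p) p = contradiction p ¬p

  𝟙-no : (p? : Dec P) → ¬ P → 𝟙 p? ≡ 0
  𝟙-no (yes p) ¬p = contradiction p ¬p
  𝟙-no (no _)  _  = refl

  ∑ˡ : List A → (A → ℕ) → ℕ
  ∑ˡ List.[]       w = 0
  ∑ˡ (x List.∷ xs) w = w x + ∑ˡ xs w

  infixl 10 ∑ˡ
  syntax ∑ˡ xs (λ x → e) = ∑[ x ∈ xs ] e

  length-filter≡∑𝟙 : {P : A → Set ℓ₁} (P? : Decidable P) (xs : List A) →
                  length (filter P? xs) ≡ ∑[ x ∈ xs ] 𝟙 (P? x)
  length-filter≡∑𝟙 P? List.[] = refl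
  length-filter≡∑𝟙 P? (x List.∷ xs) with P? x
  ... | yes _ = cong suc (length-filter≡∑𝟙 P? xs)
  ... | no _  = length-filter≡∑𝟙 P? xs

  ∑ˡ-cong : (xs : List A) {v w : A → ℕ} → (∀ x → v x ≡ w x) → ∑ˡ xs v ≡ ∑ˡ xs w
  ∑ˡ-cong List.[]       eq = refl
  ∑ˡ-cong (x List.∷ xs) eq = cong₂ _+_ (eq x) (∑ˡ-cong xs eq)

  ∑ˡ-distrib-+ : (xs : List A) (v w : A → ℕ) → ∑[ x ∈ xs ] (v x + w x) ≡ ∑ˡ xs v + ∑ˡ xs w
  ∑ˡ-distrib-+ List.[]       v w = refl
  ∑ˡ-distrib-+ (x List.∷ xs) v w = begin
    v x + w x + ∑[ y ∈ xs ] (v y + w y) ≡⟨ cong (v x + w x +_) (∑ˡ-distrib-+ xs v w) ⟩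
    v x + w x + (∑ˡ xs v + ∑ˡ xs w)     ≡⟨ interchange (v x) (w x) _ _ ⟩
    v x + ∑ˡ xs v + (w x + ∑ˡ xs w)     ∎
    where open ≡-Reasoning

  *-distribˡ-∑ˡ : (xs : List A) (c : ℕ) (w : A → ℕ) → c * ∑ˡ xs w ≡ ∑[ x ∈ xs ] (c * w x)
  *-distribˡ-∑ˡ List.[]       c w = *-zeroʳ c
  *-distribˡ-∑ˡ (x List.∷ xs) c w = trans (*-distribˡ-+ c (w x) _) (cong (c * w x +_) (*-distribˡ-∑ˡ xs c w))

  ∑ˡ-++ : (xs ys : List A) (w : A → ℕ) → ∑ˡ (xs ++ ys) w ≡ ∑ˡ xs w + ∑ˡ ys w
  ∑ˡ-++ List.[]       ys w = refl
  ∑ˡ-++ (x List.∷ xs) ys w = trans (cong (w x +_) (∑ˡ-++ xs ys w)) (sym (+-assoc (w x) _ _))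

  ∑ˡ-concatMap : ∀ {b} {B : Set b} (g : B → List A) (xs : List B) (w : A → ℕ) →
                 ∑ˡ (concatMap g xs) w ≡ ∑[ y ∈ xs ] ∑ˡ (g y) w
  ∑ˡ-concatMap g List.[]       w = refl
  ∑ˡ-concatMap g (y List.∷ ys) w = trans (∑ˡ-++ (g y) _ w) (cong (∑ˡ (g y) w +_) (∑ˡ-concatMap g ys w))

  ∑ˡ-map : ∀ {b} {B : Set b} (h : B → A) (xs : List B) (w : A → ℕ) → ∑ˡ (List.map h xs) w ≡ ∑ˡ xs (w ∘ h)
  ∑ˡ-map h List.[]       w = refl
  ∑ˡ-map h (x List.∷ xs) w = cong (w (h x) +_) (∑ˡ-map h xs w)

  ∑ˡ-tabulate : ∀ {n} (g : Fin n → A) (w : A → ℕ) → ∑ˡ (List.tabulate g) w ≡ ∑[ i < n ] w (g i)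
  ∑ˡ-tabulate {n = zero}  g w = refl
  ∑ˡ-tabulate {n = suc n} g w = cong (w (g Fin.zero) +_) (∑ˡ-tabulate (g ∘ Fin.suc) w)

  ∑-allVecs-suc : ∀ n k (w : Vec (Fin n) (suc k) → ℕ) →
                  ∑ˡ (allVecs n (suc k)) w ≡ ∑[ v ∈ allVecs n k ] ∑[ x < n ] w (x ∷ v)
  ∑-allVecs-suc n k w = trans (∑ˡ-concatMap _ (allVecs n k) w) (∑ˡ-cong (allVecs n k) λ v →
    trans (∑ˡ-map (_∷ v) (List.allFin n) w) (∑ˡ-tabulate id (w ∘ (_∷ v))))

  _≢?_ : ∀ {n} (x y : Fin n) → Dec (x ≢ y)
  x ≢? y = ¬? (x Fin.≟ y)

  ∑-punchIn : ∀ {m} (f : Fin (suc m)) (w : Fin (suc m) → ℕ) →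
              ∑[ x < suc m ] (𝟙 (x ≢? f) * w x) ≡ ∑[ y < m ] w (punchIn f y)
  ∑-punchIn {m} f w = begin
    ∑[ x < suc m ] (𝟙 (x ≢? f) * w x)                          ≡⟨ sum-remove {i = f} (λ x → 𝟙 (x ≢? f) * w x) ⟩
    𝟙 (f ≢? f) * w f + ∑[ y < m ] (𝟙 (punchIn f y ≢? f) * w (punchIn f y))
      ≡⟨ cong₂ _+_ (cong (_* w f) (𝟙-no (f ≢? f) (λ f≢f → f≢f refl)))
                   (sum-cong-≗ λ y → trans (cong (_* w (punchIn f y)) (𝟙-yes (punchIn f y ≢? f) (punchInᵢ≢i f y)))
                                           (*-identityˡ _)) ⟩
    ∑[ y < m ] w (punchIn f y)                                   ∎
    where open ≡-Reasoning

  _∉_ : ∀ {n k} → Fin n → Vec (Fin n) k → Set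
  x ∉ v = All (x ≢_) (toList v)

  _∉?_ : ∀ {n k} (x : Fin n) (v : Vec (Fin n) k) → Dec (x ∉ v)
  x ∉? v = All.all? (x ≢?_) (toList v)

  Distinct : ∀ {n k} → Vec (Fin n) k → Set
  Distinct v = Unique (toList v)

  𝟙-∉-∷ : ∀ {n k} (x y : Fin n) (v : Vec (Fin n) k) → 𝟙 (x ∉? (y ∷ v)) ≡ 𝟙 (x ≢? y) * 𝟙 (x ∉? v)
  𝟙-∉-∷ x y v = trans (𝟙-cong (λ { (x≢y ∷ x∉v) → x≢y , x∉v }) (λ (x≢y , x∉v) → x≢y ∷ x∉v) _ _)
                      (𝟙-× (x ≢? y) (x ∉? v))

  module _ {m n} {g : Fin m → Fin n} where

    ∉-map⁺ : Injective _≡_ _≡_ g → ∀ {k z} {v : Vec (Fin m) k} → z ∉ v → g z ∉ Vec.map g v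
    ∉-map⁺ inj {v = v} z∉v =
      subst (All _) (sym (toList-map g v)) (All.map⁺ (All.map (λ z≢x gz≡gx → z≢x (inj gz≡gx)) z∉v))

    ∉-map⁻ : ∀ {k z} {v : Vec (Fin m) k} → g z ∉ Vec.map g v → z ∉ v
    ∉-map⁻ {v = v} gz∉gv =
      All.map (λ gz≢gx z≡x → gz≢gx (cong g z≡x)) (All.map⁻ (subst (All _) (toList-map g v) gz∉gv))

    𝟙-∉-map : Injective _≡_ _≡_ g → ∀ {k} z (v : Vec (Fin m) k) → 𝟙 (g z ∉? Vec.map g v) ≡ 𝟙 (z ∉? v)
    𝟙-∉-map inj z v = 𝟙-cong ∉-map⁻ (∉-map⁺ inj) _ _

    distinct-map⁺ : Injective _≡_ _≡_ g → ∀ {k} {v : Vec (Fin m) k} → Distinct v → Distinct (Vec.map g v)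
    distinct-map⁺ inj {v = v} v! = subst Unique (sym (toList-map g v)) (Unique.map⁺ inj v!)

    distinct-map⁻ : ∀ {k} {v : Vec (Fin m) k} → Distinct (Vec.map g v) → Distinct v
    distinct-map⁻ {v = v} gv! = Unique.map⁻ (subst Unique (toList-map g v) gv!)

  punchIn-injective′ : ∀ {m} (f : Fin (suc m)) → Injective _≡_ _≡_ (punchIn f)
  punchIn-injective′ f = punchIn-injective f _ _

  punchOutᵛ : ∀ {m k} (f : Fin (suc m)) (v : Vec (Fin (suc m)) k) → f ∉ v → Vec (Fin m) k
  punchOutᵛ f []      []            = []
  punchOutᵛ f (x ∷ v) (f≢x ∷ f∉v) = punchOut f≢x ∷ punchOutᵛ f v f∉v

  punchIn-punchOutᵛ : ∀ {m k} (f : Fin (suc m)) (v : Vec (Fin (suc m)) k) (f∉v : f ∉ v) →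
                      Vec.map (punchIn f) (punchOutᵛ f v f∉v) ≡ v
  punchIn-punchOutᵛ f []      []            = refl
  punchIn-punchOutᵛ f (x ∷ v) (f≢x ∷ f∉v) = cong₂ _∷_ (punchIn-punchOut f≢x) (punchIn-punchOutᵛ f v f∉v)

  distinct-punchOutᵛ : ∀ {m k} (f : Fin (suc m)) {v : Vec (Fin (suc m)) k} (f∉v : f ∉ v) →
                       Distinct v → Distinct (punchOutᵛ f v f∉v)
  distinct-punchOutᵛ f {v} f∉v v! = distinct-map⁻ (subst Distinct (sym (punchIn-punchOutᵛ f v f∉v)) v!)

  ∑-1 : ∀ n → ∑[ x < n ] 1 ≡ n
  ∑-1 zero    = refl
  ∑-1 (suc n) = cong suc (∑-1 n)

  count-∉ : ∀ {n k} (v : Vec (Fin n) k) → Distinct v → ∑[ x < n ] 𝟙 (x ∉? v) + k ≡ n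
  count-∉ {n} [] [] = trans (+-identityʳ _) (∑-1 n)
  count-∉ {suc m} {suc k} (y ∷ v) (y∉v ∷ v!) with punchOutᵛ y v y∉v | punchIn-punchOutᵛ y v y∉v
  ... | u | refl = begin
    ∑[ x < suc m ] 𝟙 (x ∉? (y ∷ ↑u)) + suc k
      ≡⟨ cong (_+ suc k) (sum-cong-≗ λ x → 𝟙-∉-∷ x y ↑u) ⟩
    ∑[ x < suc m ] (𝟙 (x ≢? y) * 𝟙 (x ∉? ↑u)) + suc k
      ≡⟨ cong (_+ suc k) (∑-punchIn y λ x → 𝟙 (x ∉? ↑u)) ⟩
    ∑[ z < m ] 𝟙 (punchIn y z ∉? ↑u) + suc k
      ≡⟨ cong (_+ suc k) (sum-cong-≗ λ z → 𝟙-∉-map (punchIn-injective′ y) z u) ⟩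
    ∑[ z < m ] 𝟙 (z ∉? u) + suc k
      ≡⟨ +-suc _ k ⟩
    suc (∑[ z < m ] 𝟙 (z ∉? u) + k)
      ≡⟨ cong suc (count-∉ u (distinct-map⁻ v!)) ⟩
    suc m ∎
    where
    open ≡-Reasoning
    ↑u = Vec.map (punchIn y) u

  count-∉-≢ : ∀ {n k} (f : Fin n) (v : Vec (Fin n) k) → Distinct v →
        ∑[ x < n ] (𝟙 (x ∉? v) * 𝟙 (x ≢? f)) + 𝟙 (f ∉? v) + k ≡ n
  count-∉-≢ {n} {k} f v v! with f ∉? v
  ... | yes f∉v = begin
    ∑[ x < n ] (𝟙 (x ∉? v) * 𝟙 (x ≢? f)) + 1 + k ≡⟨ +-assoc _ 1 k ⟩
    ∑[ x < n ] (𝟙 (x ∉? v) * 𝟙 (x ≢? f)) + suc k ≡⟨ cong (_+ suc k) (sum-cong-≗ λ x →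
                                                       trans (*-comm (𝟙 (x ∉? v)) _) (sym (𝟙-∉-∷ x f v))) ⟩
    ∑[ x < n ] 𝟙 (x ∉? (f ∷ v)) + suc k          ≡⟨ count-∉ (f ∷ v) (f∉v ∷ v!) ⟩
    n                                             ∎
    where open ≡-Reasoning
  ... | no f∈v = begin
    ∑[ x < n ] (𝟙 (x ∉? v) * 𝟙 (x ≢? f)) + 0 + k ≡⟨ cong (_+ k) (+-identityʳ _) ⟩
    ∑[ x < n ] (𝟙 (x ∉? v) * 𝟙 (x ≢? f)) + k     ≡⟨ cong (_+ k) (sum-cong-≗ λ x →
                                                       trans (sym (𝟙-× (x ∉? v) (x ≢? f)))
                                                             (𝟙-cong proj₁ (∉⇒≢ x) _ _)) ⟩
    ∑[ x < n ] 𝟙 (x ∉? v) + k                    ≡⟨ count-∉ v v! ⟩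
    n                                             ∎
    where
    open ≡-Reasoning
    ∉⇒≢ : ∀ x → x ∉ v → x ∉ v × x ≢ f
    ∉⇒≢ x x∉v = x∉v , λ { refl → f∈v x∉v }

  Avoids : ∀ {n k} → Vec (Fin n) k → Vec (Fin n) k → Set
  Avoids fs v = Distinct v × (∀ j → lookup v j ≢ lookup fs j)

  avoids? : ∀ {n k} (fs : Vec (Fin n) k) → Decidable (Avoids fs)
  avoids? fs v = UniqueDec.unique? Fin._≟_ (toList v) ×-dec Fin.all? (λ j → lookup v j ≢? lookup fs j)

  #Avoiding : ∀ {n k} → Vec (Fin n) k → ℕ
  #Avoiding {n} {k} fs = ∑[ v ∈ allVecs n k ] 𝟙 (avoids? fs v)

  D≡#Avoiding : ∀ {n} (fs : Vec (Fin n) n) → (∀ i → lookup fs i ≡ i) → D n ≡ #Avoiding fs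
  D≡#Avoiding {n} fs fsᵢ≡i = trans (length-filter≡∑𝟙 (isDerangement? n) (allVecs n n)) (∑ˡ-cong (allVecs n n) λ σ →
    𝟙-cong (λ (σ! , σᵢ≢i) → σ! , λ j → σᵢ≢i j ∘ flip trans (fsᵢ≡i j))
           (λ (σ! , σᵢ≢fsᵢ) → σ! , λ j → σᵢ≢fsᵢ j ∘ flip trans (sym (fsᵢ≡i j))) _ _)

  𝟙-avoids-∷ : ∀ {n k} (f x : Fin n) (fs v : Vec (Fin n) k) →
               𝟙 (avoids? (f ∷ fs) (x ∷ v)) ≡ 𝟙 (avoids? fs v) * (𝟙 (x ∉? v) * 𝟙 (x ≢? f))
  𝟙-avoids-∷ f x fs v = begin
    𝟙 (avoids? (f ∷ fs) (x ∷ v))                   ≡⟨ 𝟙-cong split join _ _ ⟩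
    𝟙 (avoids? fs v ×-dec (x ∉? v ×-dec x ≢? f))   ≡⟨ 𝟙-× (avoids? fs v) _ ⟩
    𝟙 (avoids? fs v) * 𝟙 (x ∉? v ×-dec x ≢? f)     ≡⟨ cong (𝟙 (avoids? fs v) *_) (𝟙-× (x ∉? v) (x ≢? f)) ⟩
    𝟙 (avoids? fs v) * (𝟙 (x ∉? v) * 𝟙 (x ≢? f))   ∎
    where
    open ≡-Reasoning
    split : Avoids (f ∷ fs) (x ∷ v) → Avoids fs v × (x ∉ v × x ≢ f)
    split (x∉v ∷ v! , ≢) = (v! , ≢ ∘ Fin.suc) , x∉v , ≢ Fin.zero
    join : Avoids fs v × (x ∉ v × x ≢ f) → Avoids (f ∷ fs) (x ∷ v)
    join ((v! , ≢) , x∉v , x≢f) = x∉v ∷ v! , λ { Fin.zero → x≢f ; (Fin.suc j) → ≢ j }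

  𝟙-avoids-map : ∀ {m n k} {g : Fin m → Fin n} → Injective _≡_ _≡_ g → (fs v : Vec (Fin m) k) →
                 𝟙 (avoids? (Vec.map g fs) (Vec.map g v)) ≡ 𝟙 (avoids? fs v)
  𝟙-avoids-map {g = g} inj fs v = 𝟙-cong
    (λ (gv! , ≢) → distinct-map⁻ gv! , λ j vⱼ≡fsⱼ →
       ≢ j (trans (lookup-map j g v) (trans (cong g vⱼ≡fsⱼ) (sym (lookup-map j g fs)))))
    (λ (v! , ≢) → distinct-map⁺ inj v! , λ j gvⱼ≡gfsⱼ →
       ≢ j (inj (trans (sym (lookup-map j g v)) (trans gvⱼ≡gfsⱼ (lookup-map j g fs)))))
    _ _

  ∑-allVecs-∉ : ∀ {m} k (f : Fin (suc m)) (w : Vec (Fin (suc m)) k → ℕ) →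
                ∑[ v ∈ allVecs (suc m) k ] (𝟙 (f ∉? v) * w v) ≡ ∑[ u ∈ allVecs m k ] w (Vec.map (punchIn f) u)
  ∑-allVecs-∉ zero    f w = cong (_+ 0) (*-identityˡ (w []))
  ∑-allVecs-∉ {m} (suc k) f w = begin
    ∑[ v ∈ allVecs (suc m) (suc k) ] (𝟙 (f ∉? v) * w v)                      ≡⟨ ∑-allVecs-suc (suc m) k _ ⟩
    ∑[ v ∈ allVecs (suc m) k ] ∑[ x < suc m ] (𝟙 (f ∉? (x ∷ v)) * w (x ∷ v)) ≡⟨ ∑ˡ-cong (allVecs (suc m) k) inner ⟩
    ∑[ v ∈ allVecs (suc m) k ] (𝟙 (f ∉? v) * w′ v)                           ≡⟨ ∑-allVecs-∉ k f w′ ⟩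
    ∑[ u ∈ allVecs m k ] w′ (Vec.map (punchIn f) u)                          ≡⟨ ∑-allVecs-suc m k _ ⟨
    ∑[ u ∈ allVecs m (suc k) ] w (Vec.map (punchIn f) u)                     ∎
    where
    open ≡-Reasoning
    w′ : Vec (Fin (suc m)) k → ℕ
    w′ v = ∑[ y < m ] w (punchIn f y ∷ v)
    inner : ∀ v → ∑[ x < suc m ] (𝟙 (f ∉? (x ∷ v)) * w (x ∷ v)) ≡ 𝟙 (f ∉? v) * w′ v
    inner v = begin
      ∑[ x < suc m ] (𝟙 (f ∉? (x ∷ v)) * w (x ∷ v))
        ≡⟨ sum-cong-≗ pointwise ⟩
      ∑[ x < suc m ] (𝟙 (f ∉? v) * (𝟙 (x ≢? f) * w (x ∷ v)))
        ≡⟨ *-distribˡ-sum (𝟙 (f ∉? v)) (λ x → 𝟙 (x ≢? f) * w (x ∷ v)) ⟨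
      𝟙 (f ∉? v) * ∑[ x < suc m ] (𝟙 (x ≢? f) * w (x ∷ v))
        ≡⟨ cong (𝟙 (f ∉? v) *_) (∑-punchIn f (w ∘ (_∷ v))) ⟩
      𝟙 (f ∉? v) * w′ v ∎
      where
      pointwise : ∀ x → 𝟙 (f ∉? (x ∷ v)) * w (x ∷ v) ≡ 𝟙 (f ∉? v) * (𝟙 (x ≢? f) * w (x ∷ v))
      pointwise x = begin
        𝟙 (f ∉? (x ∷ v)) * w (x ∷ v)
          ≡⟨ cong (_* w (x ∷ v)) (𝟙-∉-∷ f x v) ⟩
        𝟙 (f ≢? x) * 𝟙 (f ∉? v) * w (x ∷ v)
          ≡⟨ cong (λ i → i * 𝟙 (f ∉? v) * w (x ∷ v)) (𝟙-cong ≢-sym ≢-sym (f ≢? x) (x ≢? f)) ⟩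
        𝟙 (x ≢? f) * 𝟙 (f ∉? v) * w (x ∷ v)
          ≡⟨ xy∙z≈y∙xz (𝟙 (x ≢? f)) _ _ ⟩
        𝟙 (f ∉? v) * (𝟙 (x ≢? f) * w (x ∷ v)) ∎

  -- A vector x ∷ v avoids f ∷ fs iff v avoids fs and x ∉ v, x ≢ f. For distinct v there are
  -- suc m - k - [f ∉ v] such x, and the v avoiding fs with f ∉ v are the images under punchIn f
  -- of the vectors avoiding fs with f punched out.
  #Avoiding-∷ : ∀ {m k} (f : Fin (suc m)) (fs : Vec (Fin (suc m)) k) (f∉fs : f ∉ fs) →
                #Avoiding (f ∷ fs) + #Avoiding (punchOutᵛ f fs f∉fs) + k * #Avoiding fs ≡ suc m * #Avoiding fs
  #Avoiding-∷ {m} {k} f fs f∉fs = begin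
    #Avoiding (f ∷ fs) + #Avoiding fs′ + k * #Avoiding fs
      ≡⟨ cong₂ (λ s t → s + t + k * #Avoiding fs) #Avoiding-f∷fs #Avoiding-fs′ ⟩
    ∑[ v ∈ V ] (ok v * T v) + ∑[ v ∈ V ] (𝟙 (f ∉? v) * ok v) + k * ∑[ v ∈ V ] ok v
      ≡⟨ cong (∑[ v ∈ V ] (ok v * T v) + ∑[ v ∈ V ] (𝟙 (f ∉? v) * ok v) +_) (*-distribˡ-∑ˡ V k ok) ⟩
    ∑[ v ∈ V ] (ok v * T v) + ∑[ v ∈ V ] (𝟙 (f ∉? v) * ok v) + ∑[ v ∈ V ] (k * ok v)
      ≡⟨ cong (_+ ∑[ v ∈ V ] (k * ok v)) (∑ˡ-distrib-+ V _ _) ⟨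
    ∑[ v ∈ V ] (ok v * T v + 𝟙 (f ∉? v) * ok v) + ∑[ v ∈ V ] (k * ok v)
      ≡⟨ ∑ˡ-distrib-+ V _ _ ⟨
    ∑[ v ∈ V ] (ok v * T v + 𝟙 (f ∉? v) * ok v + k * ok v)
      ≡⟨ ∑ˡ-cong V pointwise ⟩
    ∑[ v ∈ V ] (suc m * ok v)
      ≡⟨ *-distribˡ-∑ˡ V (suc m) ok ⟨
    suc m * #Avoiding fs ∎
    where
    open ≡-Reasoning
    V = allVecs (suc m) k
    fs′ = punchOutᵛ f fs f∉fs
    ok : Vec (Fin (suc m)) k → ℕ
    ok v = 𝟙 (avoids? fs v)
    T : Vec (Fin (suc m)) k → ℕ
    T v = ∑[ x < suc m ] (𝟙 (x ∉? v) * 𝟙 (x ≢? f))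
    #Avoiding-f∷fs : #Avoiding (f ∷ fs) ≡ ∑[ v ∈ V ] (ok v * T v)
    #Avoiding-f∷fs = trans (∑-allVecs-suc (suc m) k _) (∑ˡ-cong V λ v →
      trans (sum-cong-≗ λ x → 𝟙-avoids-∷ f x fs v) (sym (*-distribˡ-sum (ok v) λ x → 𝟙 (x ∉? v) * 𝟙 (x ≢? f))))
    #Avoiding-fs′ : #Avoiding fs′ ≡ ∑[ v ∈ V ] (𝟙 (f ∉? v) * ok v)
    #Avoiding-fs′ = sym (trans (∑-allVecs-∉ k f ok) (∑ˡ-cong (allVecs m k) λ u →
      trans (cong (λ gs → 𝟙 (avoids? gs (Vec.map (punchIn f) u))) (sym (punchIn-punchOutᵛ f fs f∉fs)))
            (𝟙-avoids-map (punchIn-injective′ f) fs′ u)))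
    pointwise : ∀ v → ok v * T v + 𝟙 (f ∉? v) * ok v + k * ok v ≡ suc m * ok v
    pointwise v with avoids? fs v
    ... | yes (v! , _) = begin
      1 * T v + 𝟙 (f ∉? v) * 1 + k * 1 ≡⟨ cong₂ (λ s t → s + t + k * 1) (*-identityˡ (T v)) (*-identityʳ _) ⟩
      T v + 𝟙 (f ∉? v) + k * 1         ≡⟨ cong (T v + 𝟙 (f ∉? v) +_) (*-identityʳ k) ⟩
      T v + 𝟙 (f ∉? v) + k             ≡⟨ count-∉-≢ f v v! ⟩
      suc m                            ≡⟨ *-identityʳ (suc m) ⟨
      suc m * 1                        ∎
    ... | no _ = trans (cong₂ _+_ (*-zeroʳ (𝟙 (f ∉? v))) (*-zeroʳ k)) (sym (*-zeroʳ (suc m)))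

  #Avoiding-irrelevant : ∀ {m n k} → m ≡ n → (fs : Vec (Fin m) k) (gs : Vec (Fin n) k) →
                         Distinct fs → Distinct gs → #Avoiding fs ≡ #Avoiding gs
  #Avoiding-irrelevant refl [] [] _ _ = refl
  #Avoiding-irrelevant {suc m} {k = suc k} refl (f ∷ fs) (g ∷ gs) (f∉fs ∷ fs!) (g∉gs ∷ gs!) =
    +-cancelʳ-≡ (#Avoiding fs′ + k * #Avoiding fs) _ _ (begin
      #Avoiding (f ∷ fs) + (#Avoiding fs′ + k * #Avoiding fs) ≡⟨ unfold f fs f∉fs ⟩
      suc m * #Avoiding fs                                    ≡⟨ cong (suc m *_) fs≈gs ⟩
      suc m * #Avoiding gs                                    ≡⟨ unfold g gs g∉gs ⟨
      #Avoiding (g ∷ gs) + (#Avoiding gs′ + k * #Avoiding gs) ≡⟨ cong (λ t → #Avoiding (g ∷ gs) + (t + k * #Avoiding gs))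
                                                                       (#Avoiding-irrelevant refl gs′ fs′ gs′! fs′!) ⟩
      #Avoiding (g ∷ gs) + (#Avoiding fs′ + k * #Avoiding gs) ≡⟨ cong (λ t → #Avoiding (g ∷ gs) + (#Avoiding fs′ + k * t))
                                                                       (sym fs≈gs) ⟩
      #Avoiding (g ∷ gs) + (#Avoiding fs′ + k * #Avoiding fs) ∎)
    where
    open ≡-Reasoning
    fs′ = punchOutᵛ f fs f∉fs
    gs′ = punchOutᵛ g gs g∉gs
    fs′! = distinct-punchOutᵛ f f∉fs fs!
    gs′! = distinct-punchOutᵛ g g∉gs gs!
    fs≈gs : #Avoiding fs ≡ #Avoiding gs
    fs≈gs = #Avoiding-irrelevant refl fs gs fs! gs!
    unfold : ∀ h (hs : Vec (Fin (suc m)) k) (h∉hs : h ∉ hs) →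
             #Avoiding (h ∷ hs) + (#Avoiding (punchOutᵛ h hs h∉hs) + k * #Avoiding hs) ≡ suc m * #Avoiding hs
    unfold h hs h∉hs = trans (sym (+-assoc (#Avoiding (h ∷ hs)) _ _)) (#Avoiding-∷ h hs h∉hs)

  canonical : ∀ {n} k → k ≤ n → Vec (Fin n) k
  canonical zero    _         = []
  canonical (suc k) (s≤s k≤n) = Fin.zero ∷ Vec.map Fin.suc (canonical k k≤n)

  zero∉map-suc : ∀ {n k} (v : Vec (Fin n) k) → Fin.zero ∉ Vec.map Fin.suc v
  zero∉map-suc v = subst (All _) (sym (toList-map Fin.suc v)) (All.map⁺ (All.universal (λ _ ()) (toList v)))

  canonical-distinct : ∀ {n} k (k≤n : k ≤ n) → Distinct (canonical k k≤n)
  canonical-distinct zero    _         = []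
  canonical-distinct (suc k) (s≤s k≤n) =
    zero∉map-suc (canonical k k≤n) ∷ distinct-map⁺ suc-injective (canonical-distinct k k≤n)

  lookup-canonical : ∀ {n} (n≤n : n ≤ n) (i : Fin n) → lookup (canonical n n≤n) i ≡ i
  lookup-canonical (s≤s n≤n) Fin.zero    = refl
  lookup-canonical (s≤s n≤n) (Fin.suc i) = trans (lookup-map i Fin.suc (canonical _ n≤n)) (cong Fin.suc (lookup-canonical n≤n i))

  -- D′ r k counts the permutations of a (k + r)-set with no fixed point among k prescribed points:
  -- the images of those points form an injection avoiding them, and the other r points can then be
  -- mapped in r ! ways.
  D′ : ℕ → ℕ → ℕ
  D′ r k = #Avoiding (canonical k (m≤m+n k r)) * r !

  D≡D′ : ∀ n → D n ≡ D′ 0 n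
  D≡D′ n = begin
    D n                                         ≡⟨ D≡#Avoiding (canonical n ≤-refl) (lookup-canonical ≤-refl) ⟩
    #Avoiding (canonical n ≤-refl)              ≡⟨ #Avoiding-irrelevant (sym (+-identityʳ n)) _ _
                                                     (canonical-distinct n ≤-refl) (canonical-distinct n (m≤m+n n 0)) ⟩
    #Avoiding (canonical n (m≤m+n n 0))         ≡⟨ *-identityʳ _ ⟨
    D′ 0 n                                      ∎
    where open ≡-Reasoning

  D′-zero : ∀ r → D′ r 0 ≡ r !
  D′-zero r = *-identityˡ (r !)

  D′-pascal : ∀ r k → D′ (suc r) k ≡ D′ r (suc k) + D′ r k
  D′-pascal r k = begin
    a * (suc r * r !)      ≡⟨ *-assoc a (suc r) (r !) ⟨
    a * suc r * r !        ≡⟨ cong (_* r !) (*-comm a (suc r)) ⟩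
    suc r * a * r !        ≡⟨ cong (_* r !) (+-cancelʳ-≡ (k * a) _ _ recurrence) ⟨
    (x + b) * r !          ≡⟨ *-distribʳ-+ (r !) x b ⟩
    D′ r (suc k) + D′ r k  ∎
    where
    open ≡-Reasoning
    cs  = canonical k (m≤m+n k r)
    cs! = canonical-distinct k (m≤m+n k r)
    fs  = Vec.map Fin.suc cs
    fs! = distinct-map⁺ suc-injective cs!
    0∉fs = zero∉map-suc cs
    fs′ = punchOutᵛ Fin.zero fs 0∉fs
    a = #Avoiding (canonical k (m≤m+n k (suc r)))
    b = #Avoiding cs
    x = #Avoiding (canonical (suc k) (m≤m+n (suc k) r))
    split : ∀ k r a → suc (k + r) * a ≡ suc r * a + k * a
    split = solve-∀
    recurrence : x + b + k * a ≡ suc r * a + k * a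
    recurrence = begin
      x + b + k * a                  ≡⟨ cong₂ (λ s t → x + s + k * t)
                                          (#Avoiding-irrelevant refl cs fs′ cs! (distinct-punchOutᵛ Fin.zero 0∉fs fs!))
                                          (#Avoiding-irrelevant (+-suc k r) _ fs (canonical-distinct k _) fs!) ⟩
      x + #Avoiding fs′ + k * #Avoiding fs ≡⟨ #Avoiding-∷ Fin.zero fs 0∉fs ⟩
      suc (k + r) * #Avoiding fs     ≡⟨ cong (suc (k + r) *_)
                                          (#Avoiding-irrelevant (sym (+-suc k r)) fs _ fs! (canonical-distinct k _)) ⟩
      suc (k + r) * a                ≡⟨ split k r a ⟩
      suc r * a + k * a              ∎

  D′-one : ∀ r → D′ r 1 ≡ r * r !
  D′-one r = +-cancelʳ-≡ (r !) _ _ (begin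
    D′ r 1 + r !      ≡⟨ cong (D′ r 1 +_) (D′-zero r) ⟨
    D′ r 1 + D′ r 0   ≡⟨ D′-pascal r 0 ⟨
    D′ (suc r) 0      ≡⟨ D′-zero (suc r) ⟩
    r ! + r * r !     ≡⟨ +-comm (r !) (r * r !) ⟩
    r * r ! + r !     ∎)
    where open ≡-Reasoning

  -- Induction on k with r generalised, since D′-pascal trades a unit of k for a unit of r.
  D′-recurrence : ∀ r k → D′ r (2 + k) ≡ suc (r + k) * D′ r (1 + k) + suc k * D′ r k
  D′-recurrence r zero = +-cancelʳ-≡ (D′ r 1) _ _ (begin
    D′ r 2 + D′ r 1                          ≡⟨ D′-pascal r 1 ⟨
    D′ (suc r) 1                             ≡⟨ D′-one (suc r) ⟩
    suc r * (suc r * r !)                    ≡⟨ expand r (r !) ⟩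
    suc (r + 0) * (r * r !) + 1 * r ! + r * r ! ≡⟨ cong₂ (λ s t → suc (r + 0) * s + 1 * t + s) (D′-one r) (D′-zero r) ⟨
    suc (r + 0) * D′ r 1 + 1 * D′ r 0 + D′ r 1 ∎)
    where
    open ≡-Reasoning
    expand : ∀ r f → suc r * (suc r * f) ≡ suc (r + 0) * (r * f) + 1 * f + r * f
    expand = solve-∀
  D′-recurrence r (suc k) = +-cancelʳ-≡ (D′ r (2 + k)) _ _ (begin
    D′ r (3 + k) + D′ r (2 + k)                                       ≡⟨ D′-pascal r (2 + k) ⟨
    D′ (suc r) (2 + k)                                                ≡⟨ D′-recurrence (suc r) k ⟩
    suc (suc r + k) * D′ (suc r) (1 + k) + suc k * D′ (suc r) k
      ≡⟨ cong₂ (λ s t → suc (suc r + k) * s + suc k * t) (D′-pascal r (1 + k)) (D′-pascal r k) ⟩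
    suc (suc r + k) * (D′ r (2 + k) + D′ r (1 + k)) + suc k * (D′ r (1 + k) + D′ r k)
      ≡⟨ regroup r k (D′ r (2 + k)) (D′ r (1 + k)) (D′ r k) ⟩
    next + (suc (r + k) * D′ r (1 + k) + suc k * D′ r k)              ≡⟨ cong (next +_) (D′-recurrence r k) ⟨
    next + D′ r (2 + k)                                               ∎)
    where
    open ≡-Reasoning
    next = suc (r + suc k) * D′ r (2 + k) + suc (suc k) * D′ r (1 + k)
    regroup : ∀ r k a b c → suc (suc r + k) * (a + b) + suc k * (b + c)
                            ≡ suc (r + suc k) * a + suc (suc k) * b + (suc (r + k) * b + suc k * c)
    regroup = solve-∀

  D-recurrence : ∀ k → D (2 + k) ≡ suc k * (D (1 + k) + D k)
  D-recurrence k = begin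
    D (2 + k)                            ≡⟨ D≡D′ (2 + k) ⟩
    D′ 0 (2 + k)                         ≡⟨ D′-recurrence 0 k ⟩
    suc k * D′ 0 (1 + k) + suc k * D′ 0 k ≡⟨ *-distribˡ-+ (suc k) (D′ 0 (1 + k)) (D′ 0 k) ⟨
    suc k * (D′ 0 (1 + k) + D′ 0 k)       ≡⟨ cong₂ (λ s t → suc k * (s + t)) (D≡D′ (1 + k)) (D≡D′ k) ⟨
    suc k * (D (1 + k) + D k)             ∎
    where open ≡-Reasoning

module Estimates where

  open Counting using (D-recurrence)
  open import Data.Nat as ℕ using (ℕ; zero; suc; _!; z≤n; s≤s; NonZero)
  import Data.Nat.Properties as ℕ
  open import Data.Nat.Tactic.RingSolver using (solve-∀)
  open import Data.Integer as ℤ using ()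
  import Data.Integer.Properties as ℤ
  open import Data.Rational as ℚ using (ℚ; _/_; _+_; _*_; _-_; -_; _≤_; _<_; 0ℚ; 1ℚ; toℚᵘ; nonNegative)
  open import Data.Rational.Properties
  import Data.Rational.Unnormalised as ℚᵘ
  import Data.Rational.Unnormalised.Properties as ℚᵘ
  open import Data.Rational.Solver using (module +-*-Solver)
  open import Data.Product using (_×_; _,_; proj₁; proj₂; Σ-syntax)
  open import Data.Sum using (_⊎_; inj₁; inj₂; [_,_]′)
  open import Relation.Binary.PropositionalEquality

  open import Algebra.Properties.Ring +-*-ring using (-1*x≈-x; -‿involutive)
  open import Algebra.Bundles using (CommutativeMonoid)
  open import Algebra.Properties.CommutativeSemigroup (CommutativeMonoid.commutativeSemigroup *-1-commutativeMonoid)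
    using (x∙yz≈y∙xz)
  open import Algebra.Properties.CommutativeSemigroup (CommutativeMonoid.commutativeSemigroup +-0-commutativeMonoid)
    using (interchange)
  open +-*-Solver using (solve; _:+_; _:*_; _:-_; :-_; _:=_; con)

  private
    toℚᵘ-/ : ∀ a b .{{_ : NonZero b}} → toℚᵘ (ℤ.+ a / b) ℚᵘ.≃ ℚᵘ.mkℚᵘ (ℤ.+ a) (ℕ.pred b)
    toℚᵘ-/ a (suc b) = toℚᵘ-fromℚᵘ (ℚᵘ.mkℚᵘ (ℤ.+ a) b)

  frac-≤ : ∀ a b c d .{{_ : NonZero b}} .{{_ : NonZero d}} → a ℕ.* d ℕ.≤ c ℕ.* b → ℤ.+ a / b ≤ ℤ.+ c / d
  frac-≤ a b@(suc _) c d@(suc _) ad≤cb = toℚᵘ-cancel-≤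
    (ℚᵘ.≤-respˡ-≃ (ℚᵘ.≃-sym (toℚᵘ-/ a b)) (ℚᵘ.≤-respʳ-≃ (ℚᵘ.≃-sym (toℚᵘ-/ c d))
      (ℚᵘ.*≤* (subst₂ ℤ._≤_ (ℤ.pos-* a d) (ℤ.pos-* c b) (ℤ.+≤+ ad≤cb)))))

  frac-< : ∀ a b c d .{{_ : NonZero b}} .{{_ : NonZero d}} → a ℕ.* d ℕ.< c ℕ.* b → ℤ.+ a / b < ℤ.+ c / d
  frac-< a b@(suc _) c d@(suc _) ad<cb = toℚᵘ-cancel-<
    (ℚᵘ.<-respˡ-≃ (ℚᵘ.≃-sym (toℚᵘ-/ a b)) (ℚᵘ.<-respʳ-≃ (ℚᵘ.≃-sym (toℚᵘ-/ c d))
      (ℚᵘ.*<* (subst₂ ℤ._<_ (ℤ.pos-* a d) (ℤ.pos-* c b) (ℤ.+<+ ad<cb)))))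

  frac-* : ∀ a b c d e f .{{_ : NonZero b}} .{{_ : NonZero d}} .{{_ : NonZero f}} →
           a ℕ.* c ℕ.* f ≡ e ℕ.* (b ℕ.* d) → (ℤ.+ a / b) * (ℤ.+ c / d) ≡ ℤ.+ e / f
  frac-* a b@(suc _) c d@(suc _) e f@(suc _) acf≡ebd = toℚᵘ-injective (ℚᵘ.≃-trans (toℚᵘ-homo-* (ℤ.+ a / b) (ℤ.+ c / d))
    (ℚᵘ.≃-trans (ℚᵘ.*-cong (toℚᵘ-/ a b) (toℚᵘ-/ c d))
    (ℚᵘ.≃-trans (ℚᵘ.*≡* (begin
        ℤ.+ a ℤ.* ℤ.+ c ℤ.* ℤ.+ f   ≡⟨ cong (ℤ._* ℤ.+ f) (ℤ.pos-* a c) ⟨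
        ℤ.+ (a ℕ.* c) ℤ.* ℤ.+ f     ≡⟨ ℤ.pos-* (a ℕ.* c) f ⟨
        ℤ.+ (a ℕ.* c ℕ.* f)         ≡⟨ cong ℤ.+_ acf≡ebd ⟩
        ℤ.+ (e ℕ.* (b ℕ.* d))       ≡⟨ ℤ.pos-* e (b ℕ.* d) ⟩
        ℤ.+ e ℤ.* ℤ.+ (b ℕ.* d)     ∎))
    (ℚᵘ.≃-sym (toℚᵘ-/ e f)))))
    where open ≡-Reasoning

  frac-+ : ∀ a b c d e f .{{_ : NonZero b}} .{{_ : NonZero d}} .{{_ : NonZero f}} →
           (a ℕ.* d ℕ.+ c ℕ.* b) ℕ.* f ≡ e ℕ.* (b ℕ.* d) → (ℤ.+ a / b) + (ℤ.+ c / d) ≡ ℤ.+ e / f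
  frac-+ a b@(suc _) c d@(suc _) e f@(suc _) eq = toℚᵘ-injective (ℚᵘ.≃-trans (toℚᵘ-homo-+ (ℤ.+ a / b) (ℤ.+ c / d))
    (ℚᵘ.≃-trans (ℚᵘ.+-cong (toℚᵘ-/ a b) (toℚᵘ-/ c d))
    (ℚᵘ.≃-trans (ℚᵘ.*≡* (begin
        (ℤ.+ a ℤ.* ℤ.+ d ℤ.+ ℤ.+ c ℤ.* ℤ.+ b) ℤ.* ℤ.+ f
          ≡⟨ cong (ℤ._* ℤ.+ f) (cong₂ ℤ._+_ (ℤ.pos-* a d) (ℤ.pos-* c b)) ⟨
        (ℤ.+ (a ℕ.* d) ℤ.+ ℤ.+ (c ℕ.* b)) ℤ.* ℤ.+ f  ≡⟨ cong (ℤ._* ℤ.+ f) (ℤ.pos-+ (a ℕ.* d) (c ℕ.* b)) ⟨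
        ℤ.+ (a ℕ.* d ℕ.+ c ℕ.* b) ℤ.* ℤ.+ f          ≡⟨ ℤ.pos-* (a ℕ.* d ℕ.+ c ℕ.* b) f ⟨
        ℤ.+ ((a ℕ.* d ℕ.+ c ℕ.* b) ℕ.* f)            ≡⟨ cong ℤ.+_ eq ⟩
        ℤ.+ (e ℕ.* (b ℕ.* d))                        ≡⟨ ℤ.pos-* e (b ℕ.* d) ⟩
        ℤ.+ e ℤ.* ℤ.+ (b ℕ.* d)                      ∎))
    (ℚᵘ.≃-sym (toℚᵘ-/ e f)))))
    where open ≡-Reasoning

  ℕ→ℚ-+ : ∀ a b → ℕ→ℚ (a ℕ.+ b) ≡ ℕ→ℚ a + ℕ→ℚ b
  ℕ→ℚ-+ a b = sym (frac-+ a 1 b 1 (a ℕ.+ b) 1 (lemma a b))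
    where
    lemma : ∀ a b → (a ℕ.* 1 ℕ.+ b ℕ.* 1) ℕ.* 1 ≡ (a ℕ.+ b) ℕ.* (1 ℕ.* 1)
    lemma = solve-∀

  ℕ→ℚ-* : ∀ a b → ℕ→ℚ (a ℕ.* b) ≡ ℕ→ℚ a * ℕ→ℚ b
  ℕ→ℚ-* a b = sym (frac-* a 1 b 1 (a ℕ.* b) 1 (lemma a b))
    where
    lemma : ∀ a b → a ℕ.* b ℕ.* 1 ≡ a ℕ.* b ℕ.* (1 ℕ.* 1)
    lemma = solve-∀

  ℕ→ℚ-mono-≤ : ∀ {a b} → a ℕ.≤ b → ℕ→ℚ a ≤ ℕ→ℚ b
  ℕ→ℚ-mono-≤ {a} {b} a≤b = frac-≤ a 1 b 1 (subst₂ ℕ._≤_ (sym (ℕ.*-identityʳ a)) (sym (ℕ.*-identityʳ b)) a≤b)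

  0≤ℕ→ℚ : ∀ a → 0ℚ ≤ ℕ→ℚ a
  0≤ℕ→ℚ a = ℕ→ℚ-mono-≤ {0} {a} z≤n

  1/_! : ℕ → ℚ
  1/ k ! = _/_ (ℤ.+ 1) (k !) {{k ℕ.!≢0}}

  0≤1/! : ∀ k → 0ℚ ≤ 1/ k !
  0≤1/! k = frac-≤ 0 1 1 (k !) {{_}} {{k ℕ.!≢0}} z≤n

  1/!-antitone : ∀ k → 1/ (suc k) ! ≤ 1/ k !
  1/!-antitone k = frac-≤ 1 (suc k !) 1 (k !) {{suc k ℕ.!≢0}} {{k ℕ.!≢0}}
    (subst₂ ℕ._≤_ (sym (ℕ.*-identityˡ (k !))) (sym (ℕ.*-identityˡ (suc k !))) (ℕ.m≤m+n (k !) (k ℕ.* k !)))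

  suc*1/suc! : ∀ k → ℕ→ℚ (suc k) * 1/ (suc k) ! ≡ 1/ k !
  suc*1/suc! k = frac-* (suc k) 1 1 (suc k !) 1 (k !) {{_}} {{suc k ℕ.!≢0}} {{k ℕ.!≢0}} (lemma k (k !))
    where
    lemma : ∀ k f → suc k ℕ.* 1 ℕ.* f ≡ 1 ℕ.* (1 ℕ.* (suc k ℕ.* f))
    lemma = solve-∀

  !*1/! : ∀ k → ℕ→ℚ (k !) * 1/ k ! ≡ 1ℚ
  !*1/! k = frac-* (k !) 1 1 (k !) 1 1 {{_}} {{k ℕ.!≢0}} (lemma (k !))
    where
    lemma : ∀ f → f ℕ.* 1 ℕ.* 1 ≡ 1 ℕ.* (1 ℕ.* f)
    lemma = solve-∀

  !*1/suc! : ∀ k → ℕ→ℚ (k !) * 1/ (suc k) ! ≡ ℤ.+ 1 / suc k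
  !*1/suc! k = frac-* (k !) 1 1 (suc k !) 1 (suc k) {{_}} {{suc k ℕ.!≢0}} (lemma k (k !))
    where
    lemma : ∀ k f → f ℕ.* 1 ℕ.* suc k ≡ 1 ℕ.* (1 ℕ.* (suc k ℕ.* f))
    lemma = solve-∀

  *-monoˡ-≤-≥0 : ∀ {r p q} → 0ℚ ≤ r → p ≤ q → r * p ≤ r * q
  *-monoˡ-≤-≥0 {r} 0≤r = *-monoˡ-≤-nonNeg r {{nonNegative 0≤r}}

  *-monoʳ-≤-≥0 : ∀ {r p q} → 0ℚ ≤ r → p ≤ q → p * r ≤ q * r
  *-monoʳ-≤-≥0 {r} 0≤r = *-monoʳ-≤-nonNeg r {{nonNegative 0≤r}}

  0≤* : ∀ {p q} → 0ℚ ≤ p → 0ℚ ≤ q → 0ℚ ≤ p * q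
  0≤* {p} 0≤p 0≤q = subst (_≤ p * _) (*-zeroʳ p) (*-monoˡ-≤-≥0 0≤p 0≤q)

  p≤p+q : ∀ {p q} → 0ℚ ≤ q → p ≤ p + q
  p≤p+q {p} 0≤q = subst (_≤ p + _) (+-identityʳ p) (+-monoʳ-≤ p 0≤q)

  p-q≤p : ∀ {p q} → 0ℚ ≤ q → p - q ≤ p
  p-q≤p {p} {q} 0≤q = subst (p - q ≤_) (+-identityʳ p) (+-monoʳ-≤ p (neg-antimono-≤ 0≤q))

  sign : ℕ → ℚ
  sign zero    = 1ℚ
  sign (suc k) = - sign k

  sign-suc-suc : ∀ k → sign (2 ℕ.+ k) ≡ sign k
  sign-suc-suc k = -‿involutive (sign k)

  ±1/_! : ℕ → ℚ
  ±1/ k ! = sign k * 1/ k !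

  sign-parity : ∀ k → sign k ≡ 1ℚ ⊎ sign k ≡ - 1ℚ
  sign-parity zero = inj₁ refl
  sign-parity (suc k) with sign-parity k
  ... | inj₁ even = inj₂ (cong -_ even)
  ... | inj₂ odd  = inj₁ (cong -_ odd)

  D-signed : ∀ k → ℕ→ℚ (D (suc k)) ≡ ℕ→ℚ (suc k) * ℕ→ℚ (D k) + sign (suc k)
  D-signed zero    = refl
  D-signed (suc k) = begin
    ℕ→ℚ (D (2 ℕ.+ k))                        ≡⟨ cong ℕ→ℚ (D-recurrence k) ⟩
    ℕ→ℚ (suc k ℕ.* (D (1 ℕ.+ k) ℕ.+ D k))    ≡⟨ ℕ→ℚ-* (suc k) (D (1 ℕ.+ k) ℕ.+ D k) ⟩
    n * ℕ→ℚ (D (1 ℕ.+ k) ℕ.+ D k)            ≡⟨ cong (n *_) (ℕ→ℚ-+ (D (1 ℕ.+ k)) (D k)) ⟩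
    n * (a + b)                               ≡⟨ step n a b s (D-signed k) ⟩
    (1ℚ + n) * a - s                          ≡⟨ cong (λ m → m * a - s) (ℕ→ℚ-+ 1 (suc k)) ⟨
    ℕ→ℚ (2 ℕ.+ k) * a + sign (2 ℕ.+ k)        ∎
    where
    open ≡-Reasoning
    n = ℕ→ℚ (suc k)
    a = ℕ→ℚ (D (suc k))
    b = ℕ→ℚ (D k)
    s = sign (suc k)
    step : ∀ n a b s → a ≡ n * b + s → n * (a + b) ≡ (1ℚ + n) * a - s
    step n .(n * b + s) b s refl =
      solve 3 (λ n b s → n :* ((n :* b :+ s) :+ b) := (con 1ℚ :+ n) :* (n :* b :+ s) :- s) refl n b s

  d : ℕ → ℚ
  d k = ℕ→ℚ (D k) * 1/ k !

  0≤d : ∀ k → 0ℚ ≤ d k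
  0≤d k = 0≤* (0≤ℕ→ℚ (D k)) (0≤1/! k)

  d-suc : ∀ k → d (suc k) ≡ d k + ±1/ (suc k) !
  d-suc k = begin
    ℕ→ℚ (D (suc k)) * u         ≡⟨ cong (_* u) (D-signed k) ⟩
    (n * ℕ→ℚ (D k) + s) * u     ≡⟨ regroup n (ℕ→ℚ (D k)) s u ⟩
    ℕ→ℚ (D k) * (n * u) + s * u ≡⟨ cong (λ x → ℕ→ℚ (D k) * x + s * u) (suc*1/suc! k) ⟩
    d k + s * u                 ∎
    where
    open ≡-Reasoning
    n = ℕ→ℚ (suc k)
    s = sign (suc k)
    u = 1/ (suc k) !
    regroup : ∀ n b s u → (n * b + s) * u ≡ b * (n * u) + s * u
    regroup = solve 4 (λ n b s u → (n :* b :+ s) :* u := b :* (n :* u) :+ s :* u) refl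

  !*d : ∀ k → ℕ→ℚ (k !) * d k ≡ ℕ→ℚ (D k)
  !*d k = begin
    ℕ→ℚ (k !) * (ℕ→ℚ (D k) * 1/ k !) ≡⟨ x∙yz≈y∙xz (ℕ→ℚ (k !)) (ℕ→ℚ (D k)) (1/ k !) ⟩
    ℕ→ℚ (D k) * (ℕ→ℚ (k !) * 1/ k !) ≡⟨ cong (ℕ→ℚ (D k) *_) (!*1/! k) ⟩
    ℕ→ℚ (D k) * 1ℚ                    ≡⟨ *-identityʳ _ ⟩
    ℕ→ℚ (D k)                         ∎
    where open ≡-Reasoning

  !*d-suc : ∀ k → ℕ→ℚ (k !) * d (suc k) ≡ ℕ→ℚ (D k) + sign (suc k) * (ℤ.+ 1 / suc k)
  !*d-suc k = begin
    F * d (suc k)           ≡⟨ cong (F *_) (d-suc k) ⟩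
    F * (d k + s * u)       ≡⟨ *-distribˡ-+ F (d k) (s * u) ⟩
    F * d k + F * (s * u)   ≡⟨ cong₂ _+_ (!*d k) (x∙yz≈y∙xz F s u) ⟩
    ℕ→ℚ (D k) + s * (F * u) ≡⟨ cong (λ x → ℕ→ℚ (D k) + s * x) (!*1/suc! k) ⟩
    ℕ→ℚ (D k) + s * (ℤ.+ 1 / suc k) ∎
    where
    open ≡-Reasoning
    F = ℕ→ℚ (k !)
    s = sign (suc k)
    u = 1/ (suc k) !

  module Alternating (a u : ℕ → ℚ) (a-suc : ∀ k → a (suc k) ≡ a k + sign (suc k) * u (suc k))
                     (0≤u : ∀ k → 0ℚ ≤ u k) (u-antitone : ∀ k → u (suc k) ≤ u k) where

    private
      a-suc-down : ∀ k → sign (suc k) ≡ - 1ℚ → a (suc k) ≡ a k - u (suc k)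
      a-suc-down k s≡-1 = begin
        a (suc k)                         ≡⟨ a-suc k ⟩
        a k + sign (suc k) * u (suc k)    ≡⟨ cong (λ s → a k + s * u (suc k)) s≡-1 ⟩
        a k + - 1ℚ * u (suc k)            ≡⟨ cong (a k +_) (-1*x≈-x (u (suc k))) ⟩
        a k - u (suc k)                   ∎
        where open ≡-Reasoning

      a-suc-up : ∀ k → sign (suc k) ≡ 1ℚ → a (suc k) ≡ a k + u (suc k)
      a-suc-up k s≡1 = trans (a-suc k) (trans (cong (λ s → a k + s * u (suc k)) s≡1) (cong (a k +_) (*-identityˡ (u (suc k)))))

      cancel : ∀ x y → x - y + y ≡ x
      cancel = solve 2 (λ x y → x :- y :+ y := x) refl

      cancel′ : ∀ x y → x + y - y ≡ x
      cancel′ = solve 2 (λ x y → x :+ y :- y := x) refl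

      down : ∀ k → sign (suc k) ≡ - 1ℚ → a (suc k) ≤ a k
      down k s≡-1 = subst (_≤ a k) (sym (a-suc-down k s≡-1)) (p-q≤p (0≤u (suc k)))

      up : ∀ k → sign (suc k) ≡ 1ℚ → a k ≤ a (suc k)
      up k s≡1 = subst (a k ≤_) (sym (a-suc-up k s≡1)) (p≤p+q (0≤u (suc k)))

      two-down : ∀ k → sign (suc k) ≡ - 1ℚ → a (2 ℕ.+ k) ≤ a k
      two-down k s≡-1 = begin
        a (2 ℕ.+ k)                         ≡⟨ a-suc-up (suc k) (cong -_ s≡-1) ⟩
        a (suc k) + u (2 ℕ.+ k)             ≡⟨ cong (_+ u (2 ℕ.+ k)) (a-suc-down k s≡-1) ⟩
        a k - u (suc k) + u (2 ℕ.+ k)       ≤⟨ +-monoʳ-≤ (a k - u (suc k)) (u-antitone (suc k)) ⟩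
        a k - u (suc k) + u (suc k)         ≡⟨ cancel (a k) (u (suc k)) ⟩
        a k                                 ∎
        where open ≤-Reasoning

      two-up : ∀ k → sign (suc k) ≡ 1ℚ → a k ≤ a (2 ℕ.+ k)
      two-up k s≡1 = begin
        a k                                 ≡⟨ cancel′ (a k) (u (suc k)) ⟨
        a k + u (suc k) - u (suc k)         ≤⟨ +-monoʳ-≤ (a k + u (suc k)) (neg-antimono-≤ (u-antitone (suc k))) ⟩
        a k + u (suc k) - u (2 ℕ.+ k)       ≡⟨ cong (_- u (2 ℕ.+ k)) (a-suc-up k s≡1) ⟨
        a (suc k) - u (2 ℕ.+ k)             ≡⟨ a-suc-down (suc k) (cong -_ s≡1) ⟨
        a (2 ℕ.+ k)                         ∎
        where open ≤-Reasoning

      +-suc-suc : ∀ t k → t ℕ.+ (2 ℕ.+ k) ≡ 2 ℕ.+ (t ℕ.+ k)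
      +-suc-suc t k = trans (ℕ.+-suc t (suc k)) (cong suc (ℕ.+-suc t k))

    tail≤even : ∀ {k} → sign k ≡ 1ℚ → ∀ t → a (t ℕ.+ k) ≤ a k
    tail≤even             s≡1 zero          = ≤-refl
    tail≤even {k}         s≡1 (suc zero)    = down k (cong -_ s≡1)
    tail≤even {k}         s≡1 (suc (suc t)) = begin
      a (2 ℕ.+ t ℕ.+ k)     ≡⟨ cong a (+-suc-suc t k) ⟨
      a (t ℕ.+ (2 ℕ.+ k))   ≤⟨ tail≤even (trans (sign-suc-suc k) s≡1) t ⟩
      a (2 ℕ.+ k)           ≤⟨ two-down k (cong -_ s≡1) ⟩
      a k                   ∎
      where open ≤-Reasoning

    odd≤tail : ∀ {k} → sign k ≡ - 1ℚ → ∀ t → a k ≤ a (t ℕ.+ k)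
    odd≤tail             s≡-1 zero          = ≤-refl
    odd≤tail {k}         s≡-1 (suc zero)    = up k (cong -_ s≡-1)
    odd≤tail {k}         s≡-1 (suc (suc t)) = begin
      a k                   ≤⟨ two-up k (cong -_ s≡-1) ⟩
      a (2 ℕ.+ k)           ≤⟨ odd≤tail (trans (sign-suc-suc k) s≡-1) t ⟩
      a (t ℕ.+ (2 ℕ.+ k))   ≡⟨ cong a (+-suc-suc t k) ⟩
      a (2 ℕ.+ t ℕ.+ k)     ∎
      where open ≤-Reasoning

  open Alternating d 1/_! d-suc 0≤1/! 1/!-antitone public

  d≤1 : ∀ j → d j ≤ 1ℚ
  d≤1 j = subst (λ i → d i ≤ 1ℚ) (ℕ.+-identityʳ j) (tail≤even refl j)

  ∑ₐ : ℕ → (ℕ → ℕ → ℚ) → ℚ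
  ∑ₐ zero    h = h 0 0
  ∑ₐ (suc K) h = h 0 (suc K) + ∑ₐ K (λ i j → h (suc i) j)

  syntax ∑ₐ K (λ i j → e) = ∑[ i + j ≡ K ] e

  ∑ₐ-cong : ∀ K {h h′ : ℕ → ℕ → ℚ} → (∀ i j → i ℕ.+ j ≡ K → h i j ≡ h′ i j) → ∑ₐ K h ≡ ∑ₐ K h′
  ∑ₐ-cong zero    eq = eq 0 0 refl
  ∑ₐ-cong (suc K) eq = cong₂ _+_ (eq 0 (suc K) refl) (∑ₐ-cong K λ i j i+j≡K → eq (suc i) j (cong suc i+j≡K))

  ∑ₐ-distrib-+ : ∀ K (h h′ : ℕ → ℕ → ℚ) → ∑[ i + j ≡ K ] (h i j + h′ i j) ≡ ∑ₐ K h + ∑ₐ K h′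
  ∑ₐ-distrib-+ zero    h h′ = refl
  ∑ₐ-distrib-+ (suc K) h h′ = trans (cong (h 0 (suc K) + h′ 0 (suc K) +_) (∑ₐ-distrib-+ K _ _))
                                    (interchange (h 0 (suc K)) (h′ 0 (suc K)) _ _)

  *-distribˡ-∑ₐ : ∀ K c (h : ℕ → ℕ → ℚ) → c * ∑ₐ K h ≡ ∑[ i + j ≡ K ] (c * h i j)
  *-distribˡ-∑ₐ zero    c h = refl
  *-distribˡ-∑ₐ (suc K) c h = trans (*-distribˡ-+ c (h 0 (suc K)) _) (cong (c * h 0 (suc K) +_) (*-distribˡ-∑ₐ K c _))

  ∑ₐ-suc : ∀ K (h : ℕ → ℕ → ℚ) → ∑ₐ (suc K) h ≡ ∑[ i + j ≡ K ] h i (suc j) + h (suc K) 0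
  ∑ₐ-suc zero    h = refl
  ∑ₐ-suc (suc K) h = trans (cong (h 0 (2 ℕ.+ K) +_) (∑ₐ-suc K λ i j → h (suc i) j)) (sym (+-assoc (h 0 (2 ℕ.+ K)) _ _))

  ∑ₐ-≤-bound : ∀ K {h : ℕ → ℕ → ℚ} {c} → (∀ i j → h i j ≤ c) → ∑ₐ K h ≤ ℕ→ℚ (suc K) * c
  ∑ₐ-≤-bound zero    {c = c} h≤c = subst (_ ≤_) (sym (*-identityˡ c)) (h≤c 0 0)
  ∑ₐ-≤-bound (suc K) {h} {c} h≤c = begin
    ∑ₐ (suc K) h                ≤⟨ +-mono-≤ (h≤c 0 (suc K)) (∑ₐ-≤-bound K λ i j → h≤c (suc i) j) ⟩
    c + ℕ→ℚ (suc K) * c         ≡⟨ cong (_+ ℕ→ℚ (suc K) * c) (*-identityˡ c) ⟨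
    1ℚ * c + ℕ→ℚ (suc K) * c    ≡⟨ *-distribʳ-+ c 1ℚ (ℕ→ℚ (suc K)) ⟨
    (1ℚ + ℕ→ℚ (suc K)) * c      ≡⟨ cong (_* c) (ℕ→ℚ-+ 1 (suc K)) ⟨
    ℕ→ℚ (2 ℕ.+ K) * c           ∎
    where open ≤-Reasoning

  0≤∑ₐ : ∀ K {h : ℕ → ℕ → ℚ} → (∀ i j → 0ℚ ≤ h i j) → 0ℚ ≤ ∑ₐ K h
  0≤∑ₐ zero    0≤h = 0≤h 0 0
  0≤∑ₐ (suc K) 0≤h = +-mono-≤ (0≤h 0 (suc K)) (0≤∑ₐ K λ i j → 0≤h (suc i) j)

  h0K≤∑ₐ : ∀ K {h : ℕ → ℕ → ℚ} → (∀ i j → 0ℚ ≤ h i j) → h 0 K ≤ ∑ₐ K h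
  h0K≤∑ₐ zero    0≤h = ≤-refl
  h0K≤∑ₐ (suc K) 0≤h = p≤p+q (0≤∑ₐ K λ i j → 0≤h (suc i) j)

  ∑ₐ-neg : ∀ K (h : ℕ → ℕ → ℚ) → ∑[ i + j ≡ K ] (- h i j) ≡ - ∑ₐ K h
  ∑ₐ-neg zero    h = refl
  ∑ₐ-neg (suc K) h = trans (cong (- h 0 (suc K) +_) (∑ₐ-neg K _)) (sym (neg-distrib-+ (h 0 (suc K)) _))

  suc*x≡0⇒x≡0 : ∀ n x → ℕ→ℚ (suc n) * x ≡ 0ℚ → x ≡ 0ℚ
  suc*x≡0⇒x≡0 n x n*x≡0 = begin
    x                                  ≡⟨ *-identityˡ x ⟨
    1ℚ * x                             ≡⟨ cong (_* x) inverse ⟨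
    ℤ.+ 1 / suc n * ℕ→ℚ (suc n) * x    ≡⟨ *-assoc (ℤ.+ 1 / suc n) _ x ⟩
    ℤ.+ 1 / suc n * (ℕ→ℚ (suc n) * x)  ≡⟨ cong (ℤ.+ 1 / suc n *_) n*x≡0 ⟩
    ℤ.+ 1 / suc n * 0ℚ                 ≡⟨ *-zeroʳ (ℤ.+ 1 / suc n) ⟩
    0ℚ                                 ∎
    where
    open ≡-Reasoning
    lemma : ∀ n → 1 ℕ.* suc n ℕ.* 1 ≡ 1 ℕ.* (suc n ℕ.* 1)
    lemma = solve-∀
    inverse : ℤ.+ 1 / suc n * ℕ→ℚ (suc n) ≡ 1ℚ
    inverse = frac-* 1 (suc n) (suc n) 1 1 1 (lemma n)

  suc*±1/suc! : ∀ j → ℕ→ℚ (suc j) * ±1/ (suc j) ! ≡ - ±1/ j !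
  suc*±1/suc! j = begin
    ℕ→ℚ (suc j) * (- sign j * 1/ (suc j) !)   ≡⟨ x∙yz≈y∙xz (ℕ→ℚ (suc j)) (- sign j) (1/ (suc j) !) ⟩
    - sign j * (ℕ→ℚ (suc j) * 1/ (suc j) !)   ≡⟨ cong (- sign j *_) (suc*1/suc! j) ⟩
    - sign j * 1/ j !                         ≡⟨ neg-distribˡ-* (sign j) (1/ j !) ⟨
    - ±1/ j !                                 ∎
    where open ≡-Reasoning

  -- (1 - 1) ^ suc K / (suc K) ! = 0: multiplying by suc K = i + j splits the sum into two copies
  -- of the K-th sum, shifted in i and in j, which carry opposite signs.
  ∑-1/!*±1/!≡0 : ∀ K → ∑[ i + j ≡ suc K ] (1/ i ! * ±1/ j !) ≡ 0ℚ
  ∑-1/!*±1/!≡0 K = suc*x≡0⇒x≡0 K _ (begin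
    ℕ→ℚ (suc K) * ∑ₐ (suc K) g                                 ≡⟨ *-distribˡ-∑ₐ (suc K) (ℕ→ℚ (suc K)) g ⟩
    ∑[ i + j ≡ suc K ] (ℕ→ℚ (suc K) * g i j)                    ≡⟨ ∑ₐ-cong (suc K) split ⟩
    ∑[ i + j ≡ suc K ] (ℕ→ℚ i * 1/ i ! * ±1/ j ! + 1/ i ! * (ℕ→ℚ j * ±1/ j !))
      ≡⟨ ∑ₐ-distrib-+ (suc K) (λ i j → ℕ→ℚ i * 1/ i ! * ±1/ j !) (λ i j → 1/ i ! * (ℕ→ℚ j * ±1/ j !)) ⟩
    ∑[ i + j ≡ suc K ] (ℕ→ℚ i * 1/ i ! * ±1/ j !) + ∑[ i + j ≡ suc K ] (1/ i ! * (ℕ→ℚ j * ±1/ j !))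
      ≡⟨ cong₂ _+_ shift-i shift-j ⟩
    ∑ₐ K g - ∑ₐ K g                                             ≡⟨ +-inverseʳ (∑ₐ K g) ⟩
    0ℚ                                                          ∎)
    where
    open ≡-Reasoning
    g : ℕ → ℕ → ℚ
    g i j = 1/ i ! * ±1/ j !
    split : ∀ i j → i ℕ.+ j ≡ suc K →
            ℕ→ℚ (suc K) * g i j ≡ ℕ→ℚ i * 1/ i ! * ±1/ j ! + 1/ i ! * (ℕ→ℚ j * ±1/ j !)
    split i j i+j≡K = begin
      ℕ→ℚ (suc K) * g i j                 ≡⟨ cong (λ n → ℕ→ℚ n * g i j) i+j≡K ⟨
      ℕ→ℚ (i ℕ.+ j) * g i j               ≡⟨ cong (_* g i j) (ℕ→ℚ-+ i j) ⟩
      (ℕ→ℚ i + ℕ→ℚ j) * (1/ i ! * ±1/ j !) ≡⟨ solve 4 (λ a b u v → (a :+ b) :* (u :* v) := a :* u :* v :+ u :* (b :* v))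
                                                     refl (ℕ→ℚ i) (ℕ→ℚ j) (1/ i !) (±1/ j !) ⟩
      ℕ→ℚ i * 1/ i ! * ±1/ j ! + 1/ i ! * (ℕ→ℚ j * ±1/ j !) ∎
    shift-i : ∑[ i + j ≡ suc K ] (ℕ→ℚ i * 1/ i ! * ±1/ j !) ≡ ∑ₐ K g
    shift-i = begin
      0ℚ * ±1/ (suc K) ! + ∑[ i + j ≡ K ] (ℕ→ℚ (suc i) * 1/ (suc i) ! * ±1/ j !)
        ≡⟨ cong (_+ ∑[ i + j ≡ K ] (ℕ→ℚ (suc i) * 1/ (suc i) ! * ±1/ j !)) (*-zeroˡ (±1/ (suc K) !)) ⟩
      0ℚ + ∑[ i + j ≡ K ] (ℕ→ℚ (suc i) * 1/ (suc i) ! * ±1/ j !)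
        ≡⟨ +-identityˡ _ ⟩
      ∑[ i + j ≡ K ] (ℕ→ℚ (suc i) * 1/ (suc i) ! * ±1/ j !)
        ≡⟨ ∑ₐ-cong K (λ i j _ → cong (_* ±1/ j !) (suc*1/suc! i)) ⟩
      ∑ₐ K g ∎
    shift-j : ∑[ i + j ≡ suc K ] (1/ i ! * (ℕ→ℚ j * ±1/ j !)) ≡ - ∑ₐ K g
    shift-j = begin
      ∑[ i + j ≡ suc K ] (1/ i ! * (ℕ→ℚ j * ±1/ j !))
        ≡⟨ ∑ₐ-suc K (λ i j → 1/ i ! * (ℕ→ℚ j * ±1/ j !)) ⟩
      ∑[ i + j ≡ K ] (1/ i ! * (ℕ→ℚ (suc j) * ±1/ (suc j) !)) + 1/ (suc K) ! * 0ℚ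
        ≡⟨ cong₂ _+_ (∑ₐ-cong K (λ i j _ → cong (1/ i ! *_) (suc*±1/suc! j))) (*-zeroʳ (1/ (suc K) !)) ⟩
      ∑[ i + j ≡ K ] (1/ i ! * - ±1/ j !) + 0ℚ
        ≡⟨ +-identityʳ _ ⟩
      ∑[ i + j ≡ K ] (1/ i ! * - ±1/ j !)
        ≡⟨ ∑ₐ-cong K (λ i j _ → sym (neg-distribʳ-* (1/ i !) (±1/ j !))) ⟩
      ∑[ i + j ≡ K ] (- g i j)
        ≡⟨ ∑ₐ-neg K g ⟩
      - ∑ₐ K g ∎

  ∑-1/!*d≡1 : ∀ K → ∑[ i + j ≡ K ] (1/ i ! * d j) ≡ 1ℚ
  ∑-1/!*d≡1 zero    = refl
  ∑-1/!*d≡1 (suc K) = begin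
    ∑[ i + j ≡ suc K ] (1/ i ! * d j)
      ≡⟨ ∑ₐ-suc K (λ i j → 1/ i ! * d j) ⟩
    ∑[ i + j ≡ K ] (1/ i ! * d (suc j)) + 1/ (suc K) ! * d 0
      ≡⟨ cong (_+ 1/ (suc K) ! * d 0) (∑ₐ-cong K λ i j _ → trans (cong (1/ i ! *_) (d-suc j)) (*-distribˡ-+ (1/ i !) _ _)) ⟩
    ∑[ i + j ≡ K ] (1/ i ! * d j + 1/ i ! * ±1/ (suc j) !) + 1/ (suc K) ! * ±1/ 0 !
      ≡⟨ cong (_+ 1/ (suc K) ! * ±1/ 0 !) (∑ₐ-distrib-+ K (λ i j → 1/ i ! * d j) (λ i j → 1/ i ! * ±1/ (suc j) !)) ⟩
    ∑[ i + j ≡ K ] (1/ i ! * d j) + ∑[ i + j ≡ K ] (1/ i ! * ±1/ (suc j) !) + 1/ (suc K) ! * ±1/ 0 !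
      ≡⟨ +-assoc (∑[ i + j ≡ K ] (1/ i ! * d j)) _ _ ⟩
    ∑[ i + j ≡ K ] (1/ i ! * d j) + (∑[ i + j ≡ K ] (1/ i ! * ±1/ (suc j) !) + 1/ (suc K) ! * ±1/ 0 !)
      ≡⟨ cong₂ _+_ (∑-1/!*d≡1 K) (sym (∑ₐ-suc K λ i j → 1/ i ! * ±1/ j !)) ⟩
    1ℚ + ∑[ i + j ≡ suc K ] (1/ i ! * ±1/ j !)
      ≡⟨ cong (1ℚ +_) (∑-1/!*±1/!≡0 K) ⟩
    1ℚ + 0ℚ
      ≡⟨ +-identityʳ 1ℚ ⟩
    1ℚ ∎
    where open ≡-Reasoning

  ∑≤ : ℕ → (ℕ → ℚ) → ℚ
  ∑≤ zero    f = f 0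
  ∑≤ (suc N) f = f 0 + ∑≤ N (λ i → f (suc i))

  syntax ∑≤ N (λ i → e) = ∑[ i ≤ N ] e

  ∑≤-suc : ∀ N (f : ℕ → ℚ) → ∑≤ (suc N) f ≡ ∑≤ N f + f (suc N)
  ∑≤-suc zero    f = refl
  ∑≤-suc (suc N) f = trans (cong (f 0 +_) (∑≤-suc N λ i → f (suc i))) (sym (+-assoc (f 0) _ _))

  0≤∑≤ : ∀ N {f : ℕ → ℚ} → (∀ i → 0ℚ ≤ f i) → 0ℚ ≤ ∑≤ N f
  0≤∑≤ zero    0≤f = 0≤f 0
  0≤∑≤ (suc N) 0≤f = +-mono-≤ (0≤f 0) (0≤∑≤ N λ i → 0≤f (suc i))

  eSum≡∑1/! : ∀ N → eSum N ≡ ∑[ i ≤ N ] 1/ i !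
  eSum≡∑1/! zero    = refl
  eSum≡∑1/! (suc N) = trans (cong (_+ 1/ (suc N) !) (eSum≡∑1/! N)) (sym (∑≤-suc N 1/_!))

  0≤eSum : ∀ N → 0ℚ ≤ eSum N
  0≤eSum N = subst (0ℚ ≤_) (sym (eSum≡∑1/! N)) (0≤∑≤ N 0≤1/!)

  1≤eSum : ∀ N → 1ℚ ≤ eSum N
  1≤eSum zero    = ≤-refl
  1≤eSum (suc N) = ≤-trans (1≤eSum N) (p≤p+q (0≤1/! (suc N)))

  ∑≤*≤∑ₐ : ∀ N a {f g : ℕ → ℚ} {c} → (∀ i → 0ℚ ≤ f i) → (∀ j → 0ℚ ≤ g j) →
           (∀ t → c ≤ g (t ℕ.+ a)) → ∑≤ N f * c ≤ ∑[ i + j ≡ N ℕ.+ a ] (f i * g j)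
  ∑≤*≤∑ₐ zero    a 0≤f 0≤g c≤g =
    ≤-trans (*-monoˡ-≤-≥0 (0≤f 0) (c≤g 0)) (h0K≤∑ₐ a λ i j → 0≤* (0≤f i) (0≤g j))
  ∑≤*≤∑ₐ (suc N) a {f} {g} {c} 0≤f 0≤g c≤g = begin
    (f 0 + ∑≤ N (λ i → f (suc i))) * c                              ≡⟨ *-distribʳ-+ c (f 0) _ ⟩
    f 0 * c + ∑≤ N (λ i → f (suc i)) * c                            ≤⟨ +-mono-≤ (*-monoˡ-≤-≥0 (0≤f 0) (c≤g (suc N)))
                                                                         (∑≤*≤∑ₐ N a (λ i → 0≤f (suc i)) 0≤g c≤g) ⟩
    f 0 * g (suc N ℕ.+ a) + ∑[ i + j ≡ N ℕ.+ a ] (f (suc i) * g j)  ∎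
    where open ≤-Reasoning

  ≤-head : ∀ {f : ℕ → ℚ} → (∀ i → f (suc i) ≤ f i) → ∀ i → f i ≤ f 0
  ≤-head f-antitone zero    = ≤-refl
  ≤-head f-antitone (suc i) = ≤-trans (f-antitone i) (≤-head f-antitone i)

  ∑ₐ≤∑≤*+ : ∀ N b {f g : ℕ → ℚ} {C} → (∀ i → 0ℚ ≤ f i) → (∀ i → f (suc i) ≤ f i) →
            (∀ j → g j ≤ 1ℚ) → (∀ t → g (t ℕ.+ b) ≤ C) →
            ∑[ i + j ≡ N ℕ.+ b ] (f i * g j) ≤ ∑≤ N f * C + ℕ→ℚ b * f (suc N)
  ∑ₐ≤∑≤*+ zero zero {f} {g} {C} 0≤f _ _ g≤C =
    ≤-trans (*-monoˡ-≤-≥0 (0≤f 0) (g≤C 0)) (p≤p+q (0≤* (0≤ℕ→ℚ 0) (0≤f 1)))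
  ∑ₐ≤∑≤*+ zero (suc b) {f} {g} {C} 0≤f f-antitone g≤1 g≤C =
    +-mono-≤ (*-monoˡ-≤-≥0 (0≤f 0) (g≤C 0)) (∑ₐ-≤-bound b λ i j → begin
      f (suc i) * g j    ≤⟨ *-monoˡ-≤-≥0 (0≤f (suc i)) (g≤1 j) ⟩
      f (suc i) * 1ℚ     ≡⟨ *-identityʳ (f (suc i)) ⟩
      f (suc i)          ≤⟨ ≤-head (λ i → f-antitone (suc i)) i ⟩
      f 1                ∎)
    where open ≤-Reasoning
  ∑ₐ≤∑≤*+ (suc N) b {f} {g} {C} 0≤f f-antitone g≤1 g≤C = begin
    f 0 * g (suc N ℕ.+ b) + ∑[ i + j ≡ N ℕ.+ b ] (f (suc i) * g j)
      ≤⟨ +-mono-≤ (*-monoˡ-≤-≥0 (0≤f 0) (g≤C (suc N)))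
                  (∑ₐ≤∑≤*+ N b (λ i → 0≤f (suc i)) (λ i → f-antitone (suc i)) g≤1 g≤C) ⟩
    f 0 * C + (∑≤ N (λ i → f (suc i)) * C + ℕ→ℚ b * f (2 ℕ.+ N))
      ≡⟨ regroup (f 0) C (∑≤ N (λ i → f (suc i))) (ℕ→ℚ b * f (2 ℕ.+ N)) ⟩
    (f 0 + ∑≤ N (λ i → f (suc i))) * C + ℕ→ℚ b * f (2 ℕ.+ N)  ∎
    where
    open ≤-Reasoning
    regroup : ∀ a C s t → a * C + (s * C + t) ≡ (a + s) * C + t
    regroup = solve 4 (λ a C s t → a :* C :+ (s :* C :+ t) := (a :+ s) :* C :+ t) refl

  eSum*d≤1 : ∀ {a} → (∀ t → d a ≤ d (t ℕ.+ a)) → ∀ N → eSum N * d a ≤ 1ℚ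
  eSum*d≤1 {a} d-above N = begin
    eSum N * d a                              ≡⟨ cong (_* d a) (eSum≡∑1/! N) ⟩
    ∑≤ N 1/_! * d a                           ≤⟨ ∑≤*≤∑ₐ N a 0≤1/! 0≤d d-above ⟩
    ∑[ i + j ≡ N ℕ.+ a ] (1/ i ! * d j)       ≡⟨ ∑-1/!*d≡1 (N ℕ.+ a) ⟩
    1ℚ                                        ∎
    where open ≤-Reasoning

  1≤eSum*d+ : ∀ {b} → (∀ t → d (t ℕ.+ b) ≤ d b) → ∀ N → 1ℚ ≤ eSum N * d b + ℕ→ℚ b * 1/ (suc N) !
  1≤eSum*d+ {b} d-below N = begin
    1ℚ                                        ≡⟨ ∑-1/!*d≡1 (N ℕ.+ b) ⟨
    ∑[ i + j ≡ N ℕ.+ b ] (1/ i ! * d j)       ≤⟨ ∑ₐ≤∑≤*+ N b 0≤1/! 1/!-antitone d≤1 d-below ⟩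
    ∑≤ N 1/_! * d b + ℕ→ℚ b * 1/ (suc N) !    ≡⟨ cong (λ E → E * d b + ℕ→ℚ b * 1/ (suc N) !) (eSum≡∑1/! N) ⟨
    eSum N * d b + ℕ→ℚ b * 1/ (suc N) !       ∎
    where open ≤-Reasoning

  odd-neighbour : ∀ n {c} → 0ℚ ≤ c → ℤ.+ 1 / suc n ≤ c →
                  Σ[ a ∈ ℕ ] (∀ t → d a ≤ d (t ℕ.+ a)) × (ℕ→ℚ (D n) - c ≤ ℕ→ℚ (n !) * d a)
  odd-neighbour n {c} 0≤c 1/[1+n]≤c = [ from-even , from-odd ]′ (sign-parity n)
    where
    Neighbour : Set
    Neighbour = Σ[ a ∈ ℕ ] (∀ t → d a ≤ d (t ℕ.+ a)) × (ℕ→ℚ (D n) - c ≤ ℕ→ℚ (n !) * d a)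
    from-even : sign n ≡ 1ℚ → Neighbour
    from-even even = suc n , odd≤tail (cong -_ even) , (begin
      ℕ→ℚ (D n) - c                              ≤⟨ +-monoʳ-≤ (ℕ→ℚ (D n)) (neg-antimono-≤ 1/[1+n]≤c) ⟩
      ℕ→ℚ (D n) - ℤ.+ 1 / suc n                  ≡⟨ cong (ℕ→ℚ (D n) +_) (-1*x≈-x (ℤ.+ 1 / suc n)) ⟨
      ℕ→ℚ (D n) + - 1ℚ * (ℤ.+ 1 / suc n)         ≡⟨ cong (λ s → ℕ→ℚ (D n) + s * (ℤ.+ 1 / suc n)) (cong -_ even) ⟨
      ℕ→ℚ (D n) + sign (suc n) * (ℤ.+ 1 / suc n) ≡⟨ !*d-suc n ⟨
      ℕ→ℚ (n !) * d (suc n)                      ∎)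
      where open ≤-Reasoning
    from-odd : sign n ≡ - 1ℚ → Neighbour
    from-odd odd = n , odd≤tail odd , subst (ℕ→ℚ (D n) - c ≤_) (sym (!*d n)) (p-q≤p 0≤c)

  even-neighbour : ∀ n → Σ[ b ∈ ℕ ] (∀ t → d (t ℕ.+ b) ≤ d b)
                                    × (ℕ→ℚ (n !) * d b ≤ ℕ→ℚ (D n) + ℤ.+ 1 / suc n)
                                    × b ℕ.≤ suc n
  even-neighbour n = [ from-even , from-odd ]′ (sign-parity n)
    where
    Neighbour : Set
    Neighbour = Σ[ b ∈ ℕ ] (∀ t → d (t ℕ.+ b) ≤ d b)
                          × (ℕ→ℚ (n !) * d b ≤ ℕ→ℚ (D n) + ℤ.+ 1 / suc n)
                          × b ℕ.≤ suc n
    from-even : sign n ≡ 1ℚ → Neighbour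
    from-even even = n , tail≤even even ,
      subst (_≤ ℕ→ℚ (D n) + ℤ.+ 1 / suc n) (sym (!*d n)) (p≤p+q (frac-≤ 0 1 1 (suc n) z≤n)) , ℕ.n≤1+n n
    from-odd : sign n ≡ - 1ℚ → Neighbour
    from-odd odd = suc n , tail≤even (cong -_ odd) , ≤-reflexive (begin
      ℕ→ℚ (n !) * d (suc n)                      ≡⟨ !*d-suc n ⟩
      ℕ→ℚ (D n) + sign (suc n) * (ℤ.+ 1 / suc n) ≡⟨ cong (λ s → ℕ→ℚ (D n) + s * (ℤ.+ 1 / suc n)) (cong -_ odd) ⟩
      ℕ→ℚ (D n) + 1ℚ * (ℤ.+ 1 / suc n)           ≡⟨ cong (ℕ→ℚ (D n) +_) (*-identityˡ (ℤ.+ 1 / suc n)) ⟩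
      ℕ→ℚ (D n) + ℤ.+ 1 / suc n                  ∎) , ℕ.≤-refl
      where open ≡-Reasoning

  [D-c]·e≤n! : ∀ n {c} → 0ℚ ≤ c → ℤ.+ 1 / suc n ≤ c → (ℕ→ℚ (D n) - c) ·e≤ ℕ→ℚ (n !)
  [D-c]·e≤n! n {c} 0≤c 1/[1+n]≤c N = begin
    (ℕ→ℚ (D n) - c) * eSum N          ≤⟨ *-monoʳ-≤-≥0 (0≤eSum N) D-c≤n!d ⟩
    ℕ→ℚ (n !) * d a * eSum N          ≡⟨ *-assoc (ℕ→ℚ (n !)) (d a) (eSum N) ⟩
    ℕ→ℚ (n !) * (d a * eSum N)        ≡⟨ cong (ℕ→ℚ (n !) *_) (*-comm (d a) (eSum N)) ⟩
    ℕ→ℚ (n !) * (eSum N * d a)        ≤⟨ *-monoˡ-≤-≥0 (0≤ℕ→ℚ (n !)) (eSum*d≤1 d-above N) ⟩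
    ℕ→ℚ (n !) * 1ℚ                    ≡⟨ *-identityʳ (ℕ→ℚ (n !)) ⟩
    ℕ→ℚ (n !)                         ∎
    where
    open ≤-Reasoning
    neighbour = odd-neighbour n 0≤c 1/[1+n]≤c
    a = proj₁ neighbour
    d-above = proj₁ (proj₂ neighbour)
    D-c≤n!d = proj₂ (proj₂ neighbour)

  n!*[1+n]/[3+n]!≤1/12 : ∀ m → ℕ→ℚ (suc m !) * (ℕ→ℚ (2 ℕ.+ m) * 1/ (4 ℕ.+ m) !) ≤ ℤ.+ 1 / 12
  n!*[1+n]/[3+n]!≤1/12 m = begin
    ℕ→ℚ f * (ℕ→ℚ (2 ℕ.+ m) * 1/ (4 ℕ.+ m) !)   ≡⟨ *-assoc (ℕ→ℚ f) _ _ ⟨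
    ℕ→ℚ f * ℕ→ℚ (2 ℕ.+ m) * 1/ (4 ℕ.+ m) !     ≡⟨ cong (_* 1/ (4 ℕ.+ m) !) (ℕ→ℚ-* f (2 ℕ.+ m)) ⟨
    ℕ→ℚ a * 1/ (4 ℕ.+ m) !                     ≡⟨ frac-* a 1 1 F a F {{_}} {{F≢0}} {{F≢0}} (unit a F) ⟩
    _/_ (ℤ.+ a) F {{F≢0}}                       ≤⟨ frac-≤ a F 1 12 {{F≢0}} (subst (a ℕ.* 12 ℕ.≤_) (sym (expand m f)) (ℕ.m≤m+n _ _)) ⟩
    ℤ.+ 1 / 12                                  ∎
    where
    open ≤-Reasoning
    f = suc m !
    a = f ℕ.* (2 ℕ.+ m)
    F = (4 ℕ.+ m) !
    F≢0 = (4 ℕ.+ m) ℕ.!≢0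
    unit : ∀ x y → x ℕ.* 1 ℕ.* y ≡ x ℕ.* (1 ℕ.* y)
    unit = solve-∀
    expand : ∀ m f → 1 ℕ.* ((4 ℕ.+ m) ℕ.* ((3 ℕ.+ m) ℕ.* ((2 ℕ.+ m) ℕ.* f)))
                     ≡ f ℕ.* (2 ℕ.+ m) ℕ.* 12 ℕ.+ (m ℕ.* m ℕ.+ 7 ℕ.* m) ℕ.* (f ℕ.* (2 ℕ.+ m))
    expand = solve-∀

  1/6≤1-c-1/[1+n] : ∀ m {c} → c ≤ ℤ.+ 1 / 2 → ℤ.+ 1 / 6 ≤ 1ℚ - c - ℤ.+ 1 / (3 ℕ.+ m)
  1/6≤1-c-1/[1+n] m c≤1/2 = +-mono-≤ (+-monoʳ-≤ 1ℚ (neg-antimono-≤ c≤1/2)) (neg-antimono-≤ 1/[3+m]≤1/3)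
    where
    1/[3+m]≤1/3 : ℤ.+ 1 / (3 ℕ.+ m) ≤ ℤ.+ 1 / 3
    1/[3+m]≤1/3 = frac-≤ 1 (3 ℕ.+ m) 1 3 (ℕ.*-monoʳ-≤ 1 (ℕ.m≤m+n 3 m))

  n!*b/[n+3]!<1-c-1/[n+1] : ∀ m {b c} → b ℕ.≤ 3 ℕ.+ m → c ≤ ℤ.+ 1 / 2 →
                            ℕ→ℚ ((2 ℕ.+ m) !) * (ℕ→ℚ b * 1/ (5 ℕ.+ m) !) < 1ℚ - c - ℤ.+ 1 / (3 ℕ.+ m)
  n!*b/[n+3]!<1-c-1/[n+1] m {b} {c} b≤3+m c≤1/2 = begin-strict
    ℕ→ℚ ((2 ℕ.+ m) !) * (ℕ→ℚ b * 1/ (5 ℕ.+ m) !)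
      ≤⟨ *-monoˡ-≤-≥0 (0≤ℕ→ℚ ((2 ℕ.+ m) !)) (*-monoʳ-≤-≥0 (0≤1/! (5 ℕ.+ m)) (ℕ→ℚ-mono-≤ b≤3+m)) ⟩
    ℕ→ℚ ((2 ℕ.+ m) !) * (ℕ→ℚ (3 ℕ.+ m) * 1/ (5 ℕ.+ m) !)
      ≤⟨ n!*[1+n]/[3+n]!≤1/12 (suc m) ⟩
    ℤ.+ 1 / 12
      <⟨ frac-< 1 12 1 6 (ℕ.m≤m+n 7 5) ⟩
    ℤ.+ 1 / 6
      ≤⟨ 1/6≤1-c-1/[1+n] m c≤1/2 ⟩
    1ℚ - c - ℤ.+ 1 / (3 ℕ.+ m) ∎
    where open ≤-Reasoning

  -- N = n + 2 keeps the error term b / (N + 1)! of 1≤eSum*d+ below (1 - c - 1/(n + 1)) / n!.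
  n!<[D+1-c]·e : ∀ m {c} → c ≤ ℤ.+ 1 / 2 → ℕ→ℚ ((2 ℕ.+ m) !) < (ℕ→ℚ (suc (D (2 ℕ.+ m))) - c) ·e
  n!<[D+1-c]·e m {c} c≤1/2 = N , (begin-strict
    F                                   ≡⟨ *-identityʳ F ⟨
    F * 1ℚ                              ≤⟨ *-monoˡ-≤-≥0 (0≤ℕ→ℚ (n !)) (1≤eSum*d+ d-below N) ⟩
    F * (E * d b + β)                   ≡⟨ regroup F E (d b) β ⟩
    E * (F * d b) + F * β               ≤⟨ +-monoˡ-≤ (F * β) (*-monoˡ-≤-≥0 (0≤eSum N) n!d≤D+P) ⟩
    E * (ℕ→ℚ (D n) + P) + F * β         <⟨ +-monoʳ-< (E * (ℕ→ℚ (D n) + P)) (n!*b/[n+3]!<1-c-1/[n+1] m b≤1+n c≤1/2) ⟩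
    E * (ℕ→ℚ (D n) + P) + w             ≤⟨ +-monoʳ-≤ (E * (ℕ→ℚ (D n) + P)) w≤E*w ⟩
    E * (ℕ→ℚ (D n) + P) + E * w         ≡⟨ collect E (ℕ→ℚ (D n)) P c ⟩
    (1ℚ + ℕ→ℚ (D n) - c) * E            ≡⟨ cong (λ x → (x - c) * E) (ℕ→ℚ-+ 1 (D n)) ⟨
    (ℕ→ℚ (suc (D n)) - c) * E           ∎)
    where
    open ≤-Reasoning
    n = 2 ℕ.+ m
    N = 2 ℕ.+ n
    neighbour = even-neighbour n
    b = proj₁ neighbour
    d-below = proj₁ (proj₂ neighbour)
    n!d≤D+P = proj₁ (proj₂ (proj₂ neighbour))
    b≤1+n = proj₂ (proj₂ (proj₂ neighbour))
    F = ℕ→ℚ (n !)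
    E = eSum N
    P = ℤ.+ 1 / suc n
    β = ℕ→ℚ b * 1/ (suc N) !
    w = 1ℚ - c - P
    w≤E*w : w ≤ E * w
    w≤E*w = subst (_≤ E * w) (*-identityˡ w)
                  (*-monoʳ-≤-≥0 (≤-trans (frac-≤ 0 1 1 6 z≤n) (1/6≤1-c-1/[1+n] m c≤1/2)) (1≤eSum N))
    regroup : ∀ F E δ β → F * (E * δ + β) ≡ E * (F * δ) + F * β
    regroup = solve 4 (λ F E δ β → F :* (E :* δ :+ β) := E :* (F :* δ) :+ F :* β) refl
    collect : ∀ E x P c → E * (x + P) + E * (1ℚ - c - P) ≡ (1ℚ + x - c) * E
    collect = solve 4 (λ E x P c → E :* (x :+ P) :+ E :* (con 1ℚ :- c :- P) := (con 1ℚ :+ x :- c) :* E) refl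

  D≡⌊n!/e+c⌋ : ∀ m c → ℤ.+ 1 / (3 ℕ.+ m) ≤ c → c ≤ ℤ.+ 1 / 2 → IsFloorFactOverEPlus (2 ℕ.+ m) c (D (2 ℕ.+ m))
  D≡⌊n!/e+c⌋ m c 1/[1+n]≤c c≤1/2 = [D-c]·e≤n! (2 ℕ.+ m) 0≤c 1/[1+n]≤c , n!<[D+1-c]·e m c≤1/2
    where
    0≤c : 0ℚ ≤ c
    0≤c = ≤-trans (frac-≤ 0 1 1 (3 ℕ.+ m) z≤n) 1/[1+n]≤c

open Estimates using (frac-≤; D≡⌊n!/e+c⌋)
open import Data.Nat using (ℕ; suc; _≤_; _*_; _+_; >-nonZero; s≤s; z≤n)
open import Data.Nat.Properties using (≤-trans; n≤1+n; m≤m+n; *-monoʳ-≤)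
open import Data.Nat.Tactic.RingSolver using (solve-∀)
open import Data.Integer using (+_)
open import Data.Rational as ℚ using (_/_)
open import Data.Product using (_×_; _,_)
open import Relation.Binary.PropositionalEquality using (_≡_; subst; sym)

mainTheorem7 : (n : ℕ) → (h : 2 ≤ n)
    → IsFloorFactOverEPlus n (_/_ (+ 1) n {{>-nonZero (≤-trans (s≤s z≤n) h)}}) (D n)
      × IsFloorFactOverEPlus n (+ (n + 2) / (suc n * suc n)) (D n)
mainTheorem7 1 (s≤s ())
mainTheorem7 n@(suc (suc m)) _ =
  D≡⌊n!/e+c⌋ m _ 1/[1+n]≤1/n 1/n≤1/2 , D≡⌊n!/e+c⌋ m _ 1/[1+n]≤[n+2]/[1+n]² [n+2]/[1+n]²≤1/2
  where
  1/[1+n]≤1/n : + 1 / suc n ℚ.≤ + 1 / n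
  1/[1+n]≤1/n = frac-≤ 1 (suc n) 1 n (*-monoʳ-≤ 1 (n≤1+n n))
  1/n≤1/2 : + 1 / n ℚ.≤ + 1 / 2
  1/n≤1/2 = frac-≤ 1 n 1 2 (*-monoʳ-≤ 1 (m≤m+n 2 m))
  expand₁ : ∀ m → (2 + m + 2) * (3 + m) ≡ 1 * ((3 + m) * (3 + m)) + (3 + m)
  expand₁ = solve-∀
  expand₂ : ∀ m → 1 * ((3 + m) * (3 + m)) ≡ (2 + m + 2) * 2 + (1 + 4 * m + m * m)
  expand₂ = solve-∀
  1/[1+n]≤[n+2]/[1+n]² : + 1 / suc n ℚ.≤ + (n + 2) / (suc n * suc n)
  1/[1+n]≤[n+2]/[1+n]² = frac-≤ 1 (suc n) (n + 2) (suc n * suc n)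
    (subst (1 * (suc n * suc n) ≤_) (sym (expand₁ m)) (m≤m+n _ _))
  [n+2]/[1+n]²≤1/2 : + (n + 2) / (suc n * suc n) ℚ.≤ + 1 / 2
  [n+2]/[1+n]²≤1/2 = frac-≤ (n + 2) (suc n * suc n) 1 2
    (subst ((n + 2) * 2 ≤_) (sym (expand₂ m)) (m≤m+n _ _))
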